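{- Let $h\ge2$, let $a/b$ be an $h$-Farey fraction, $\Delta\subset\mathbb N$ finite, $\tau,m$ integers, $S=S(h,a/b,\Delta,\tau,m)$ and $S^+=S(h,a/b+1,\Delta,\tau,m)$, both satisfying the standing assumptions below, and assume $S$ is canonically defined. Then $S^+$ is collision-free if and only if $S$ is collision-free, and in this case $S$ and $S^+$ have the same Eliahou number.
   Context: For a positive integer $m$, a finite set $\Gamma$ of integers larger than $m$ and an integer $c>m$, $\langle m,\Gamma\rangle_c$ denotes the submonoid of $(\mathbb N,+)$ generated by $m$, the elements of $\Gamma$ and all integers $\ge c$. An element $x>0$ of such $S$ is primitive if it is not the sum of two nonzero elements of $S$; $S$ is canonically defined if $m$ and all elements of $\Gamma$ are primitive and $c-1\notin S$. Parameters (with respect to $c$): $k=|S\cap[0,c)|$; $\ell$ = number of primitive elements below $c$; $r$ = number of primitive elements $\ge c$; $q=\lceil c/m\rceil$; Eliahou number $E=k\ell+qr-c$. For a finite set $A$ and $i\ge0$, $iA$ is the $i$-fold sumset ($0A=\{0\}$). A finite $A\subset\mathbb Z$ is a $B_h$ set if $|hA|=\binom{|A|+h-1}{h}$. Let $h\ge2$. An $h$-Farey fraction is a reduced fraction $a/b$ with $a\in\mathbb Z$, $1\le b\le h$; its predecessor $a'/b'$ is the largest $h$-Farey fraction strictly less than $a/b$. For a finite $\Delta\subset\mathbb N$ and integers $\tau,m$, $S(h,a/b,\Delta,\tau,m)=\langle m,\Gamma\rangle_c$ with $c=\lfloor ahm/b\rfloor-m-\tau$ and $\Gamma=\{\lfloor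 (c+m-1)/h\rfloor-\delta:\delta\in\Delta\}$. Put $\gamma_1=\min\Gamma$, $w=c+m-h\gamma_1$. Standing assumptions: all elements of $\Gamma$ exceed $m$; $m\ge w$ (equivalently $h\Gamma\subset[c,c+m)$); and $a'/b'<(c+m)/(hm)\le a/b$. Collision-free: every element of $[c,c+m)$ can be written in a unique way as a combination of generators; equivalently, $\Gamma$ is a $B_h$ set and the sumsets $i\Gamma$, $0\le i\le h$, are pairwise disjoint modulo $m$. -}

module Defs where

open import Data.Nat as ℕ using (ℕ; zero; suc)
open import Data.Nat.Coprimality using (Coprime)
open import Data.Nat.Combinatorics using (_C_)
open import Data.Integer as ℤ using (ℤ; +_; -[1+_]; _+_; _-_; _*_; _≤_; _<_; ∣_∣)
open import Data.Integer.Divisibility using (_∣_)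
open import Data.Rational.Unnormalised as Q using (ℚᵘ; 0ℚᵘ; floor; ceiling)
open import Data.List using (List; length; map)
open import Data.List.Membership.Propositional using (_∈_)
open import Data.List.Relation.Unary.Unique.Propositional using (Unique)
open import Data.Product using (Σ; ∃; ∃-syntax; _×_; _,_)
open import Relation.Binary.PropositionalEquality using (_≡_; _≢_)
open import Relation.Nullary using (¬_)
open import Function.Bundles using (_⇔_)

-- x / d as an (unnormalised) rational; only meaningful for d > 0
-- (returns 0 otherwise, a case excluded by all hypotheses where it is used).
_÷_ : ℤ → ℤ → ℚᵘ
x ÷ (+ suc n) = x Q./ suc n
x ÷ _         = 0ℚᵘ

infixl 7 _÷_

Card : (ℤ → Set) → ℕ → Set
Card P n = Σ (List ℤ) λ L → Unique L × (∀ x → (x ∈ L) ⇔ P x) × length L ≡ n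

data InS (m : ℤ) (Γ : List ℤ) (c : ℤ) : ℤ → Set where
  s-zero : InS m Γ c (+ 0)
  s-m    : InS m Γ c m
  s-Γ    : ∀ {x} → x ∈ Γ → InS m Γ c x
  s-c    : ∀ {x} → c ≤ x → InS m Γ c x
  s-add  : ∀ {x y} → InS m Γ c x → InS m Γ c y → InS m Γ c (x + y)

Primitive : ℤ → List ℤ → ℤ → ℤ → Set
Primitive m Γ c x =
  (+ 0 < x) × InS m Γ c x ×
  ¬ (∃[ y ] ∃[ z ] (y ≢ + 0 × z ≢ + 0 × InS m Γ c y × InS m Γ c z × x ≡ y + z))

Canonical : ℤ → List ℤ → ℤ → Set
Canonical m Γ c =
  Primitive m Γ c m × (∀ γ → γ ∈ Γ → Primitive m Γ c γ) × ¬ InS m Γ c (c - + 1)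

HasEliahou : ℤ → List ℤ → ℤ → ℤ → Set
HasEliahou m Γ c E = ∃[ k ] ∃[ l ] ∃[ r ]
  ( Card (λ x → InS m Γ c x × (+ 0 ≤ x) × (x < c)) k
  × Card (λ x → Primitive m Γ c x × (x < c)) l
  × Card (λ x → Primitive m Γ c x × (c ≤ x)) r
  × E ≡ (+ k) * (+ l) + ceiling (c ÷ m) * (+ r) - c )

data Sumset (A : List ℤ) : ℕ → ℤ → Set where
  sum-zero : Sumset A 0 (+ 0)
  sum-step : ∀ {i a x} → a ∈ A → Sumset A i x → Sumset A (suc i) (a + x)

IsBh : ℕ → List ℤ → Set
IsBh h A = ∃[ n ] (Card (λ x → x ∈ A) n × Card (Sumset A h) ((n ℕ.+ h ℕ.∸ 1) C h))

CollisionFree : ℕ → ℤ → List ℤ → Set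
CollisionFree h m Γ =
  IsBh h Γ ×
  (∀ i j → i ℕ.≤ h → j ℕ.≤ h → i ≢ j → ∀ x y →
     Sumset Γ i x → Sumset Γ j y → ¬ (m ∣ (x - y)))

Farey : ℕ → ℤ → ℕ → Set
Farey h a b = (1 ℕ.≤ b) × (b ℕ.≤ h) × Coprime ∣ a ∣ b

IsPredecessor : ℕ → ℤ → ℕ → ℤ → ℕ → Set
IsPredecessor h a b a' b' =
  Farey h a' b' × (a' ÷ + b' Q.< a ÷ + b) ×
  (∀ a'' b'' → Farey h a'' b'' → a'' ÷ + b'' Q.< a ÷ + b → a'' ÷ + b'' Q.≤ a' ÷ + b')

-- S(h, a/b, Δ, τ, m) = ⟨ m , Γ ⟩_c
cParam : ℕ → ℤ → ℕ → ℤ → ℤ → ℤ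
cParam h a b τ m = floor ((a * + h * m) ÷ + b) - m - τ

GammaParam : ℕ → ℤ → ℕ → List ℕ → ℤ → ℤ → List ℤ
GammaParam h a b Δ τ m =
  map (λ δ → floor ((cParam h a b τ m + m - + 1) ÷ + h) - + δ) Δ

IsMin : List ℤ → ℤ → Set
IsMin Γ g = g ∈ Γ × (∀ γ → γ ∈ Γ → g ≤ γ)

-- standing assumptions for S(h, a/b, Δ, τ, m)
-- (m > 0 and c > m are part of the notation ⟨ m , Γ ⟩_c)
Standing : ℕ → ℤ → ℕ → List ℕ → ℤ → ℤ → Set
Standing h a b Δ τ m =
  let c = cParam h a b τ m
      Γ = GammaParam h a b Δ τ m
  in (+ 0 < m) × (m < c) ×
     (∀ γ → γ ∈ Γ → m < γ) ×
     (∃[ γ₁ ] (IsMin Γ γ₁ × (c + m - + h * γ₁ ≤ m))) ×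
     (∃[ a' ] ∃[ b' ] (IsPredecessor h a b a' b' ×
        (a' ÷ + b' Q.< (c + m) ÷ (+ h * m)) × ((c + m) ÷ (+ h * m) Q.≤ a ÷ + b)))

-- S(h, a/b + 1, Δ, τ, m) has conductor parameter c + hm and generators Γ + m, so its sumsets are
-- iΓ + im.  Translating by multiples of m changes neither the sizes of the sumsets nor their
-- residues mod m, hence one semigroup is collision-free iff the other is.
--
-- For collision-free Γ with hΓ ⊆ [c, c + m), the sums x ∈ iΓ (i ≤ h) are pairwise incongruent
-- mod m, and the non-primitive elements of S below c + m are exactly the x + jm with x ∈ iΓ and
-- i + j ≥ 2.  Hence the primitive elements below c are m and Γ (ℓ = |Γ| + 1), the elements of S
-- below c are x, x + m, … < c for x ∈ iΓ, i < h (k = Σ ⌈(c − x)/m⌉), and the primitive elements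
-- ≥ c are the points of [c, c + m) not congruent to any x ∈ iΓ, i ≤ h (r = m − Σ_{i≤h} |iΓ|).
-- Passing to a/b + 1 keeps ℓ and r, adds Σ_{i<h} (h − i)|iΓ| to k, h to q and hm to c, so the
-- Eliahou number changes by ℓ Σ_{i<h} (h − i)|iΓ| − h Σ_{i≤h} |iΓ|.  As Γ is a B_h set,
-- |iΓ| = C(n + i − 1, i) with n = |Γ|, and the change vanishes by
-- (n + 1) Σ_{i<h} (h − i) C(n + i − 1, i) = h Σ_{i≤h} C(n + i − 1, i).

module Submission where

open import Defs

module _ where

  open import Data.Nat using (ℕ; zero; suc; _+_; _*_; _∸_; _≤_; _<_; z≤n; s≤s)
  import Data.Nat.Properties as ℕP
  open import Data.Nat.Combinatorics using (_C_; nCk+nC[k+1]≡[n+1]C[k+1])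
  open import Data.Nat.Combinatorics.Specification using (k>n⇒nCk≡0)
  open import Data.Nat.ListAction using (sum)
  import Data.Nat.Tactic.RingSolver as NS
  open import Algebra.Properties.CommutativeSemigroup ℕP.+-commutativeSemigroup
    using () renaming (interchange to +-interchange)
  open import Data.Empty using (⊥; ⊥-elim)
  open import Function.Base using (_∘_)
  open import Data.List using (List; []; _∷_; length; map; _++_; concatMap)
  open import Data.List.Properties using (length-++; length-removeAt′)
  open import Data.List.Membership.Propositional using (_∈_; _∉_; _─_)
  open import Data.List.Membership.Propositional.Properties using (∈-++⁺ˡ)
  open import Data.List.Relation.Unary.Any using (here; there; index)
  import Data.List.Relation.Unary.All as All
  import Data.List.Relation.Unary.All.Properties as Allₚ
  open import Data.List.Relation.Unary.AllPairs using (AllPairs; []; _∷_)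
  import Data.List.Relation.Unary.AllPairs.Properties as APP
  open import Data.List.Relation.Unary.Unique.Propositional using (Unique)
  import Data.List.Relation.Unary.Unique.Propositional.Properties as UP
  open import Data.List.Relation.Binary.Subset.Propositional using (_⊆_)
  open import Data.List.Relation.Binary.Disjoint.Propositional using (Disjoint)
  open import Relation.Binary.Definitions using (DecidableEquality)
  open import Relation.Binary.PropositionalEquality
    using (_≡_; _≢_; refl; sym; trans; cong; cong₂; subst; module ≡-Reasoning)
  open import Relation.Nullary using (yes; no)

  module _ {A : Set} where

    ∈-─⁻ : ∀ {x z : A} {xs} (p : x ∈ xs) → z ∈ xs ─ p → z ∈ xs
    ∈-─⁻ (here _)  q         = there q
    ∈-─⁻ (there p) (here e)  = here e
    ∈-─⁻ (there p) (there q) = there (∈-─⁻ p q)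

    ∈-─⁺ : ∀ {x z : A} {xs} (p : x ∈ xs) → z ∈ xs → z ≢ x → z ∈ xs ─ p
    ∈-─⁺ (here refl) (here refl) z≢x = ⊥-elim (z≢x refl)
    ∈-─⁺ (here _)    (there q)   _   = q
    ∈-─⁺ (there p)   (here e)    _   = here e
    ∈-─⁺ (there p)   (there q)   z≢x = there (∈-─⁺ p q z≢x)

    length-─ : ∀ {x : A} {xs} (p : x ∈ xs) → length xs ≡ suc (length (xs ─ p))
    length-─ {xs = xs} p = length-removeAt′ xs (index p)

    Unique-─ : ∀ {x : A} {xs} (p : x ∈ xs) → Unique xs → Unique (xs ─ p)
    Unique-─ (here _)  (_ ∷ u)  = u
    Unique-─ (there p) (y∉ ∷ u) = All.tabulate (λ q → All.lookup y∉ (∈-─⁻ p q)) ∷ Unique-─ p u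

    Unique⇒∉─ : ∀ {x : A} {xs} (p : x ∈ xs) → Unique xs → x ∉ xs ─ p
    Unique⇒∉─ (here refl) (x∉ ∷ _) q           = All.lookup x∉ q refl
    Unique⇒∉─ (there p)   (y∉ ∷ _) (here refl) = All.lookup y∉ p refl
    Unique⇒∉─ (there p)   (_ ∷ u)  (there q)   = Unique⇒∉─ p u q

    Unique-++⁻ˡ : ∀ (xs : List A) {ys} → Unique (xs ++ ys) → Unique xs
    Unique-++⁻ˡ []       _        = []
    Unique-++⁻ˡ (x ∷ xs) (x∉ ∷ u) = All.tabulate (λ q → All.lookup x∉ (∈-++⁺ˡ q)) ∷ Unique-++⁻ˡ xs u

    ⊆-∷⁻ : ∀ {xs ys : List A} {y} → y ∉ xs → xs ⊆ y ∷ ys → xs ⊆ ys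
    ⊆-∷⁻ y∉xs xs⊆y∷ys q with xs⊆y∷ys q
    ... | here refl = ⊥-elim (y∉xs q)
    ... | there q′  = q′

    ⊆-∷-∈ : ∀ {xs ys : List A} {y} → y ∈ ys → xs ⊆ y ∷ ys → xs ⊆ ys
    ⊆-∷-∈ y∈ys xs⊆y∷ys q with xs⊆y∷ys q
    ... | here refl = y∈ys
    ... | there q′  = q′

    Unique∧⊆⇒length-≤ : ∀ {xs ys : List A} → Unique xs → xs ⊆ ys → length xs ≤ length ys
    Unique∧⊆⇒length-≤ {[]}     _        _     = z≤n
    Unique∧⊆⇒length-≤ {x ∷ xs} (x∉ ∷ u) xs⊆ys =
      subst (suc (length xs) ≤_) (sym (length-─ x∈ys)) (s≤s (Unique∧⊆⇒length-≤ u xs⊆ys─x))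
      where
        x∈ys = xs⊆ys (here refl)
        xs⊆ys─x : xs ⊆ _ ─ x∈ys
        xs⊆ys─x q = ∈-─⁺ x∈ys (xs⊆ys (there q)) (λ z≡x → All.lookup x∉ q (sym z≡x))

    Unique∧⊆∧⊇⇒length-≡ : ∀ {xs ys : List A} → Unique xs → Unique ys → xs ⊆ ys → ys ⊆ xs →
                          length xs ≡ length ys
    Unique∧⊆∧⊇⇒length-≡ u v xs⊆ys ys⊆xs =
      ℕP.≤-antisym (Unique∧⊆⇒length-≤ u xs⊆ys) (Unique∧⊆⇒length-≤ v ys⊆xs)

    AllPairs-fromUnique : ∀ {R : A → A → Set} {xs} → Unique xs →
                          (∀ {x y} → x ∈ xs → y ∈ xs → x ≢ y → R x y) → AllPairs R xs
    AllPairs-fromUnique []       _   = []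
    AllPairs-fromUnique (x∉ ∷ u) R-≢ =
      All.tabulate (λ q → R-≢ (here refl) (there q) (All.lookup x∉ q)) ∷
      AllPairs-fromUnique u (λ p q → R-≢ (there p) (there q))

  ⊆∧length-≤⇒Unique : ∀ {A : Set} → DecidableEquality A → ∀ {xs ys : List A} →
                      Unique xs → xs ⊆ ys → length ys ≤ length xs → Unique ys
  ⊆∧length-≤⇒Unique _≟_ {xs} {[]}     _ _ _ = []
  ⊆∧length-≤⇒Unique _≟_ {xs} {y ∷ ys} u xs⊆y∷ys ∣ys∣<∣xs∣ = All.tabulate y∉ys ∷ unique-ys
    where
      open import Data.List.Membership.DecPropositional _≟_ using (_∈?_)
      too-long : xs ⊆ ys → ⊥
      too-long xs⊆ys = ℕP.<-irrefl refl (ℕP.≤-trans ∣ys∣<∣xs∣ (Unique∧⊆⇒length-≤ u xs⊆ys))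
      y∉ys : ∀ {z} → z ∈ ys → y ≢ z
      y∉ys z∈ys refl = too-long (⊆-∷-∈ z∈ys xs⊆y∷ys)
      unique-ys : Unique ys
      unique-ys with y ∈? xs
      ... | no  y∉xs = ⊥-elim (too-long (⊆-∷⁻ y∉xs xs⊆y∷ys))
      ... | yes y∈xs = ⊆∧length-≤⇒Unique _≟_ (Unique-─ y∈xs u)
                         (⊆-∷⁻ (Unique⇒∉─ y∈xs u) (xs⊆y∷ys ∘ ∈-─⁻ y∈xs))
                         (ℕP.≤-pred (subst (suc (length ys) ≤_) (length-─ y∈xs) ∣ys∣<∣xs∣))

  module _ {A B : Set} (f : A → List B) where

    length-concatMap : ∀ xs → length (concatMap f xs) ≡ sum (map (length ∘ f) xs)
    length-concatMap []       = refl
    length-concatMap (x ∷ xs) = trans (length-++ (f x)) (cong (length (f x) +_) (length-concatMap xs))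

    Unique-concatMap : ∀ {xs} → (∀ x → Unique (f x)) → AllPairs (λ x y → Disjoint (f x) (f y)) xs →
                       Unique (concatMap f xs)
    Unique-concatMap f-unique disjoint =
      UP.concat⁺ (Allₚ.map⁺ (All.tabulate (λ {x} _ → f-unique x))) (APP.map⁺ disjoint)

  sum-map-+ : ∀ {A : Set} (f : A → ℕ) k xs → sum (map (λ x → f x + k) xs) ≡ sum (map f xs) + k * length xs
  sum-map-+ f k []       = sym (ℕP.*-zeroʳ k)
  sum-map-+ f k (x ∷ xs) = begin
    f x + k + sum (map (λ x → f x + k) xs)       ≡⟨ cong (f x + k +_) (sum-map-+ f k xs) ⟩
    f x + k + (sum (map f xs) + k * length xs)   ≡⟨ +-interchange (f x) k (sum (map f xs)) (k * length xs) ⟩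
    f x + sum (map f xs) + (k + k * length xs)   ≡⟨ cong (f x + sum (map f xs) +_) (ℕP.*-suc k (length xs)) ⟨
    f x + sum (map f xs) + k * suc (length xs)   ∎
    where open ≡-Reasoning

  -- Counting multisets

  multichoose : ℕ → ℕ → ℕ
  multichoose _       zero    = 1
  multichoose zero    (suc k) = 0
  multichoose (suc n) (suc k) = multichoose (suc n) k + multichoose n (suc k)

  multichoose≡C : ∀ n k → multichoose n k ≡ (n + k ∸ 1) C k
  multichoose≡C zero    zero    = refl
  multichoose≡C (suc n) zero    = refl
  multichoose≡C zero    (suc k) = sym (k>n⇒nCk≡0 (ℕP.n<1+n k))
  multichoose≡C (suc n) (suc k) = begin
    multichoose (suc n) k + multichoose n (suc k)
      ≡⟨ cong₂ _+_ (multichoose≡C (suc n) k) (multichoose≡C n (suc k)) ⟩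
    (n + k) C k + (n + suc k ∸ 1) C suc k   ≡⟨ cong (λ t → (n + k) C k + (t ∸ 1) C suc k) (ℕP.+-suc n k) ⟩
    (n + k) C k + (n + k) C suc k           ≡⟨ nCk+nC[k+1]≡[n+1]C[k+1] (n + k) k ⟩
    suc (n + k) C suc k                     ≡⟨ cong (_C suc k) (ℕP.+-suc n k) ⟨
    (n + suc k) C suc k                     ∎
    where open ≡-Reasoning

  multichoose[n,1]≡n : ∀ n → multichoose n 1 ≡ n
  multichoose[n,1]≡n zero    = refl
  multichoose[n,1]≡n (suc n) = cong suc (multichoose[n,1]≡n n)

  multichoose[1,k]≡1 : ∀ k → multichoose 1 k ≡ 1
  multichoose[1,k]≡1 zero    = refl
  multichoose[1,k]≡1 (suc k) = trans (ℕP.+-identityʳ (multichoose 1 k)) (multichoose[1,k]≡1 k)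

  multichoose[2,k]≡1+k : ∀ k → multichoose 2 k ≡ suc k
  multichoose[2,k]≡1+k zero    = refl
  multichoose[2,k]≡1+k (suc k) =
    trans (cong₂ _+_ (multichoose[2,k]≡1+k k) (multichoose[1,k]≡1 (suc k))) (ℕP.+-comm (suc k) 1)

  multichoose-absorb : ∀ k n → suc n * multichoose (suc (suc n)) k ≡ suc k * multichoose (suc n) (suc k)
  multichoose-absorb zero n = begin
    suc n * 1                  ≡⟨ ℕP.*-identityʳ (suc n) ⟩
    suc n                      ≡⟨ cong suc (multichoose[n,1]≡n n) ⟨
    suc (multichoose n 1)      ≡⟨ ℕP.+-identityʳ _ ⟨
    1 * multichoose (suc n) 1  ∎
    where open ≡-Reasoning
  multichoose-absorb (suc k) zero = begin
    1 * multichoose 2 (suc k)                 ≡⟨ ℕP.*-identityˡ _ ⟩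
    multichoose 2 (suc k)                     ≡⟨ multichoose[2,k]≡1+k (suc k) ⟩
    suc (suc k)                               ≡⟨ ℕP.*-identityʳ _ ⟨
    suc (suc k) * 1                           ≡⟨ cong (suc (suc k) *_) (multichoose[1,k]≡1 (suc (suc k))) ⟨
    suc (suc k) * multichoose 1 (suc (suc k)) ∎
    where open ≡-Reasoning
  multichoose-absorb (suc k) (suc n) = begin
    suc (suc n) * (A + B)                  ≡⟨ ℕP.*-distribˡ-+ (suc (suc n)) A B ⟩
    suc (suc n) * A + suc (suc n) * B      ≡⟨ cong (_+ suc (suc n) * B) (multichoose-absorb k (suc n)) ⟩
    suc k * B + suc (suc n) * B            ≡⟨ shuffle k n B ⟩
    suc (suc k) * B + suc n * B            ≡⟨ cong (suc (suc k) * B +_) (multichoose-absorb (suc k) n) ⟩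
    suc (suc k) * B + suc (suc k) * D      ≡⟨ ℕP.*-distribˡ-+ (suc (suc k)) B D ⟨
    suc (suc k) * (B + D)                  ∎
    where
      open ≡-Reasoning
      A = multichoose (suc (suc (suc n))) k
      B = multichoose (suc (suc n)) (suc k)
      D = multichoose (suc n) (suc (suc k))
      shuffle : ∀ k n b → suc k * b + suc (suc n) * b ≡ suc (suc k) * b + suc n * b
      shuffle = NS.solve-∀

  sumBelow : ℕ → (ℕ → ℕ) → ℕ
  sumBelow zero    f = 0
  sumBelow (suc k) f = sumBelow k f + f k

  sumBelow-cong : ∀ k {f g : ℕ → ℕ} → (∀ i → i < k → f i ≡ g i) → sumBelow k f ≡ sumBelow k g
  sumBelow-cong zero    f≡g = refl
  sumBelow-cong (suc k) f≡g =
    cong₂ _+_ (sumBelow-cong k (λ i i<k → f≡g i (ℕP.m<n⇒m<1+n i<k))) (f≡g k ℕP.≤-refl)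

  sumBelow-+ : ∀ k (f g : ℕ → ℕ) → sumBelow k (λ i → f i + g i) ≡ sumBelow k f + sumBelow k g
  sumBelow-+ zero    f g = refl
  sumBelow-+ (suc k) f g = trans (cong (_+ (f k + g k)) (sumBelow-+ k f g))
                                 (+-interchange (sumBelow k f) (sumBelow k g) (f k) (g k))

  sumBelow-multichoose : ∀ n k → sumBelow (suc k) (multichoose n) ≡ multichoose (suc n) k
  sumBelow-multichoose n zero    = refl
  sumBelow-multichoose n (suc k) = cong (_+ multichoose n (suc k)) (sumBelow-multichoose n k)

  sumBelow-weighted : ∀ h (f : ℕ → ℕ) →
                      sumBelow h (λ i → (h ∸ i) * f i) ≡ sumBelow h (λ j → sumBelow (suc j) f)
  sumBelow-weighted zero    f = refl
  sumBelow-weighted (suc h) f = begin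
    sumBelow h (λ i → (suc h ∸ i) * f i) + (suc h ∸ h) * f h
      ≡⟨ cong₂ _+_ peel (cong (_* f h) (ℕP.m+n∸n≡m 1 h)) ⟩
    sumBelow h (λ i → f i + (h ∸ i) * f i) + 1 * f h
      ≡⟨ cong (_+ 1 * f h) (sumBelow-+ h f (λ i → (h ∸ i) * f i)) ⟩
    sumBelow h f + sumBelow h (λ i → (h ∸ i) * f i) + 1 * f h
      ≡⟨ cong (λ t → sumBelow h f + t + 1 * f h) (sumBelow-weighted h f) ⟩
    sumBelow h f + sumBelow h (λ j → sumBelow (suc j) f) + 1 * f h
      ≡⟨ rearrange (sumBelow h f) (sumBelow h (λ j → sumBelow (suc j) f)) (f h) ⟩
    sumBelow h (λ j → sumBelow (suc j) f) + (sumBelow h f + f h)   ∎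
    where
      open ≡-Reasoning
      peel : sumBelow h (λ i → (suc h ∸ i) * f i) ≡ sumBelow h (λ i → f i + (h ∸ i) * f i)
      peel = sumBelow-cong h (λ i i<h → cong (_* f i) (ℕP.+-∸-assoc 1 (ℕP.<⇒≤ i<h)))
      rearrange : ∀ a b c → a + b + 1 * c ≡ b + (a + c)
      rearrange = NS.solve-∀

  multichoose-weighted-sum : ∀ n h →
    suc n * sumBelow h (λ i → (h ∸ i) * multichoose n i) ≡ h * sumBelow (suc h) (multichoose n)
  multichoose-weighted-sum n zero    = ℕP.*-zeroʳ (suc n)
  multichoose-weighted-sum n (suc g) = begin
    suc n * sumBelow (suc g) (λ i → (suc g ∸ i) * multichoose n i)
      ≡⟨ cong (suc n *_) (sumBelow-weighted (suc g) (multichoose n)) ⟩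
    suc n * sumBelow (suc g) (λ j → sumBelow (suc j) (multichoose n))
      ≡⟨ cong (suc n *_) (sumBelow-cong (suc g) (λ j _ → sumBelow-multichoose n j)) ⟩
    suc n * sumBelow (suc g) (multichoose (suc n))
      ≡⟨ cong (suc n *_) (sumBelow-multichoose (suc n) g) ⟩
    suc n * multichoose (suc (suc n)) g
      ≡⟨ multichoose-absorb g n ⟩
    suc g * multichoose (suc n) (suc g)
      ≡⟨ cong (suc g *_) (sumBelow-multichoose n (suc g)) ⟨
    suc g * sumBelow (suc (suc g)) (multichoose n)   ∎
    where open ≡-Reasoning

module _ where

  open import Data.Nat as ℕ using (ℕ; zero; suc; z≤n; s≤s; NonZero)
  import Data.Nat.Properties as ℕP
  open import Data.Nat.Combinatorics using (_C_)
  import Data.Nat.DivMod as ND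
  import Data.Nat.Divisibility as NDv
  open import Data.Nat.ListAction using (sum)
  open import Data.Nat.ListAction.Properties using (sum-++)
  open import Algebra.Properties.CommutativeSemigroup ℕP.+-commutativeSemigroup
    using () renaming (interchange to +-interchange)
  open import Data.Integer as ℤ using (ℤ; +_; -[1+_]; _+_; _-_; _*_; -_; _≤_; _<_; ∣_∣; +≤+; +<+)
  import Data.Integer.Properties as ℤP
  import Data.Integer.DivMod as ID
  open import Data.Integer.Divisibility using (_∣_)
  import Data.Integer.Divisibility.Signed as DS
  open import Data.Integer.Tactic.RingSolver using (solve-∀)
  open import Algebra.Bundles using (AbelianGroup)
  open import Algebra.Properties.Group (AbelianGroup.group ℤP.+-0-abelianGroup)
    using () renaming (∙-cancelˡ to +-cancelˡ; ∙-cancelʳ to +-cancelʳ)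
  open import Data.Rational.Unnormalised using (floor; ceiling)
  open import Data.Product using (Σ; ∃-syntax; _×_; _,_; proj₁; proj₂)
  open import Data.Sum using (_⊎_; inj₁; inj₂; [_,_]′)
  open import Data.Empty using (⊥; ⊥-elim)
  open import Function.Base using (_∘_)
  open import Function.Bundles using (_⇔_; mk⇔; Equivalence)
  open import Data.List using (List; []; _∷_; length; map; _++_; filter; applyDownFrom; concatMap)
  open import Data.List.Properties
    using (length-map; length-++; length-applyDownFrom; map-∘; map-cong; map-cong-local; map-++)
  open import Data.List.Membership.Propositional using (_∈_; _∉_; find; lose)
  open import Data.List.Membership.Propositional.Properties
    using ( ∈-map⁺; ∈-map⁻; ∈-++⁺ˡ; ∈-++⁺ʳ; ∈-++⁻; ∈-filter⁺; ∈-filter⁻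
          ; ∈-concatMap⁺; ∈-concatMap⁻; ∈-applyDownFrom⁺; ∈-applyDownFrom⁻)
  open import Data.List.Membership.DecPropositional ℤ._≟_ using (_∈?_; _∉?_)
  open import Data.List.Relation.Unary.Any using (here; there)
  import Data.List.Relation.Unary.All as All
  open import Data.List.Relation.Unary.AllPairs as AllPairs using (AllPairs; []; _∷_)
  import Data.List.Relation.Unary.AllPairs.Properties as APP
  open import Data.List.Relation.Unary.Unique.Propositional using (Unique)
  import Data.List.Relation.Unary.Unique.Propositional.Properties as UP
  open import Data.List.Relation.Binary.Subset.Propositional using (_⊆_)
  open import Data.List.Relation.Binary.Disjoint.Propositional using (Disjoint)
  open import Relation.Binary.PropositionalEquality
    using (_≡_; _≢_; refl; sym; trans; cong; cong₂; subst; subst₂; module ≡-Reasoning)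
  open import Relation.Nullary using (¬_; yes; no)

  ≤-byDiff : ∀ {a b e} → + 0 ≤ e → b - a ≡ e → a ≤ b
  ≤-byDiff 0≤e b-a≡e = ℤP.0≤i-j⇒j≤i (subst (+ 0 ≤_) (sym b-a≡e) 0≤e)

  <-byDiff : ∀ {a b e} → + 0 ≤ e → b - a ≡ e + + 1 → a < b
  <-byDiff {a} {b} {e} 0≤e b-a≡e+1 = ℤP.suc[i]≤j⇒i<j (≤-byDiff 0≤e (begin
    b - (+ 1 + a)  ≡⟨ shift b a ⟩
    b - a - + 1    ≡⟨ cong (_- + 1) b-a≡e+1 ⟩
    e + + 1 - + 1  ≡⟨ cancel e ⟩
    e              ∎))
    where
      open ≡-Reasoning
      shift : ∀ b a → b - (+ 1 + a) ≡ b - a - + 1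
      shift = solve-∀
      cancel : ∀ e → e + + 1 - + 1 ≡ e
      cancel = solve-∀

  i<j⇒0≤j-i-1 : ∀ {i j} → i < j → + 0 ≤ j - i - + 1
  i<j⇒0≤j-i-1 {i} {j} i<j = subst (+ 0 ≤_) (shift j i) (ℤP.i≤j⇒0≤j-i (ℤP.i<j⇒suc[i]≤j i<j))
    where
      shift : ∀ j i → j - (+ 1 + i) ≡ j - i - + 1
      shift = solve-∀

  i<j⇒0<j-i : ∀ {i j} → i < j → + 0 < j - i
  i<j⇒0<j-i {i} {j} i<j = <-byDiff (i<j⇒0≤j-i-1 i<j) (reorder j i)
    where
      reorder : ∀ j i → j - i - + 0 ≡ j - i - + 1 + + 1
      reorder = solve-∀

  0≤j⇒i≤i+j : ∀ {i j} → + 0 ≤ j → i ≤ i + j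
  0≤j⇒i≤i+j {i} 0≤j = subst (_≤ i + _) (ℤP.+-identityʳ i) (ℤP.+-monoʳ-≤ i 0≤j)

  0≤+*+ : ∀ a b → + 0 ≤ + a * + b
  0≤+*+ a b = subst (+ 0 ≤_) (ℤP.pos-* a b) (+≤+ z≤n)

  i+j-j≡i : ∀ i j → i + j - j ≡ i
  i+j-j≡i = solve-∀

  i-j+j≡i : ∀ i j → i - j + j ≡ i
  i-j+j≡i = solve-∀

  floor-÷≡/ℕ : ∀ x d .{{_ : NonZero d}} → floor (x ÷ + d) ≡ x ℤ./ℕ d
  floor-÷≡/ℕ x (suc d-1) = ID.div-pos-is-/ℕ x (suc d-1)

  ceiling-÷≡-floor-÷ : ∀ x d .{{_ : NonZero d}} → ceiling (x ÷ + d) ≡ - floor ((- x) ÷ + d)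
  ceiling-÷≡-floor-÷ x (suc d-1) = refl

  module _ (d : ℕ) .{{_ : NonZero d}} where

    floor-÷-*-≤ : ∀ x → floor (x ÷ + d) * + d ≤ x
    floor-÷-*-≤ x = subst (λ q → q * + d ≤ x) (sym (floor-÷≡/ℕ x d)) (ID.[n/ℕd]*d≤n x d)

    <-floor-÷-*-+ : ∀ x → x < floor (x ÷ + d) * + d + + d
    <-floor-÷-*-+ x = subst (λ q → x < q * + d + + d) (sym (floor-÷≡/ℕ x d))
      (subst (x <_) (suc-* (x ℤ./ℕ d) (+ d)) (ID.n<s[n/ℕd]*d x d))
      where
        suc-* : ∀ q d → (+ 1 + q) * d ≡ q * d + d
        suc-* = solve-∀

    floor-÷-unique : ∀ x q → q * + d ≤ x → x < q * + d + + d → floor (x ÷ + d) ≡ q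
    floor-÷-unique x q qd≤x x<qd+d =
      ℤP.≤-antisym (below x<qd+d (floor-÷-*-≤ x)) (below (<-floor-÷-*-+ x) qd≤x)
      where
        suc-* : ∀ q d → (+ 1 + q) * d ≡ q * d + d
        suc-* = solve-∀
        below : ∀ {x p q} → x < q * + d + + d → p * + d ≤ x → p ≤ q
        below {x} {p} {q} x<qd+d pd≤x = ℤP.≮⇒≥ λ q<p → ℤP.<⇒≱ x<qd+d (ℤP.≤-trans
          (subst (_≤ p * + d) (suc-* q (+ d)) (ℤP.*-monoʳ-≤-nonNeg (+ d) (ℤP.i<j⇒suc[i]≤j q<p))) pd≤x)

    floor-÷-+-* : ∀ x y → floor ((x + y * + d) ÷ + d) ≡ floor (x ÷ + d) + y
    floor-÷-+-* x y = floor-÷-unique (x + y * + d) (q + y)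
      (subst (_≤ x + y * + d) (sym (*-distrib q y (+ d))) (ℤP.+-monoˡ-≤ (y * + d) (floor-÷-*-≤ x)))
      (subst (x + y * + d <_) (shuffle q y (+ d)) (ℤP.+-monoˡ-< (y * + d) (<-floor-÷-*-+ x)))
      where
        q = floor (x ÷ + d)
        *-distrib : ∀ q y d → (q + y) * d ≡ q * d + y * d
        *-distrib = solve-∀
        shuffle : ∀ q y d → q * d + d + y * d ≡ (q + y) * d + d
        shuffle = solve-∀

    ceiling-÷-+-* : ∀ x y → ceiling ((x + y * + d) ÷ + d) ≡ ceiling (x ÷ + d) + y
    ceiling-÷-+-* x y = begin
      ceiling ((x + y * + d) ÷ + d)        ≡⟨ ceiling-÷≡-floor-÷ (x + y * + d) d ⟩
      - floor ((- (x + y * + d)) ÷ + d)    ≡⟨ cong (λ t → - floor (t ÷ + d)) (neg-distrib x y (+ d)) ⟩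
      - floor ((- x + (- y) * + d) ÷ + d)  ≡⟨ cong -_ (floor-÷-+-* (- x) (- y)) ⟩
      - (floor ((- x) ÷ + d) + - y)        ≡⟨ neg-+-neg (floor ((- x) ÷ + d)) y ⟩
      - floor ((- x) ÷ + d) + y            ≡⟨ cong (_+ y) (ceiling-÷≡-floor-÷ x d) ⟨
      ceiling (x ÷ + d) + y                ∎
      where
        open ≡-Reasoning
        neg-distrib : ∀ x y d → - (x + y * d) ≡ - x + (- y) * d
        neg-distrib = solve-∀
        neg-+-neg : ∀ f y → - (f + - y) ≡ - f + y
        neg-+-neg = solve-∀

  module _ (m : ℕ) .{{_ : NonZero m}} where

    multiplesBelow : ℤ → ℕ
    multiplesBelow (+ suc z) = suc (z ℕ./ m)
    multiplesBelow _         = 0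

    <-multiplesBelow⇒ : ∀ {j z} → j ℕ.< multiplesBelow z → + j * + m < z
    <-multiplesBelow⇒ {j} {+ suc z} (s≤s j≤z/m) = subst (_< + suc z) (ℤP.pos-* j m)
      (+<+ (s≤s (ℕP.≤-trans (ℕP.*-monoˡ-≤ m j≤z/m) (ND.m/n*n≤m z m))))

    <-multiplesBelow⇐ : ∀ {j z} → + j * + m < z → j ℕ.< multiplesBelow z
    <-multiplesBelow⇐ {j} {z} jm<z with z | subst (_< z) (sym (ℤP.pos-* j m)) jm<z
    ... | + suc z | +<+ (s≤s jm≤z) = s≤s (subst (ℕ._≤ z ℕ./ m) (ND.m*n/n≡m j m) (ND./-monoˡ-≤ m jm≤z))

    multiplesBelow-nonpos : ∀ {z} → z ≤ + 0 → multiplesBelow z ≡ 0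
    multiplesBelow-nonpos {+ zero}    _        = refl
    multiplesBelow-nonpos { -[1+ _ ]} _        = refl
    multiplesBelow-nonpos {+ suc _}   (+≤+ ())

    ≤-multiplesBelow-* : ∀ z → z ≤ + multiplesBelow z * + m
    ≤-multiplesBelow-* z = ℤP.≮⇒≥ λ Tm<z → ℕP.<-irrefl refl (<-multiplesBelow⇐ Tm<z)

    multiplesBelow-*-< : ∀ {z} → + 0 < z → + multiplesBelow z * + m < z + + m
    multiplesBelow-*-< {+ zero}  (+<+ ())
    multiplesBelow-*-< {+ suc z} _ = subst (_< + suc z + + m) (suc-* (+ (z ℕ./ m)) (+ m))
      (ℤP.+-monoˡ-< (+ m) (<-multiplesBelow⇒ {z ℕ./ m} {+ suc z} ℕP.≤-refl))
      where
        suc-* : ∀ t m → t * m + m ≡ (+ 1 + t) * m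
        suc-* = solve-∀

    multiplesBelow-+ : ∀ {z} d → + 0 < z → multiplesBelow (z + + d * + m) ≡ multiplesBelow z ℕ.+ d
    multiplesBelow-+ {+ zero}  d (+<+ ())
    multiplesBelow-+ {+ suc z} d _ = begin
      multiplesBelow (+ suc z + + d * + m)  ≡⟨ cong (λ t → multiplesBelow (+ suc z + t)) (ℤP.pos-* d m) ⟨
      suc ((z ℕ.+ d ℕ.* m) ℕ./ m)           ≡⟨ cong suc (ND.+-distrib-/-∣ʳ z (NDv.divides-refl d)) ⟩
      suc (z ℕ./ m ℕ.+ d ℕ.* m ℕ./ m)       ≡⟨ cong (suc ∘ (z ℕ./ m ℕ.+_)) (ND.m*n/n≡m d m) ⟩
      suc (z ℕ./ m ℕ.+ d)                   ∎
      where open ≡-Reasoning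

  infix 4 _≡_[mod_]

  record _≡_[mod_] (x y m : ℤ) : Set where
    constructor mod-divides
    field divides : m ∣ (x - y)
  open _≡_[mod_]

  module _ {m : ℤ} where

    private
      signed : ∀ {x y} → x ≡ y [mod m ] → m DS.∣ (x - y)
      signed {x} {y} (mod-divides m∣x-y) = DS.∣ᵤ⇒∣ {m} {x - y} m∣x-y

      unsigned : ∀ {x y} → m DS.∣ (x - y) → x ≡ y [mod m ]
      unsigned {x} {y} m∣x-y = mod-divides (DS.∣⇒∣ᵤ {m} {x - y} m∣x-y)

    ≡[mod]-byDiff : ∀ {x y x′ y′} k → x ≡ y [mod m ] → x′ - y′ ≡ (x - y) + k * m → x′ ≡ y′ [mod m ]
    ≡[mod]-byDiff k x≡y diff =
      unsigned (subst (m DS.∣_) (sym diff) (DS.∣m∣n⇒∣m+n (signed x≡y) (DS.∣n⇒∣m*n k DS.∣-refl)))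

    ≡[mod]-byMultiple : ∀ {x y} k → x - y ≡ k * m → x ≡ y [mod m ]
    ≡[mod]-byMultiple k diff = unsigned (DS.divides k diff)

    ≡[mod]-refl : ∀ {x} → x ≡ x [mod m ]
    ≡[mod]-refl {x} = ≡[mod]-byMultiple (+ 0) (trans (ℤP.+-inverseʳ x) (sym (ℤP.*-zeroˡ m)))

    ≡[mod]-sym : ∀ {x y} → x ≡ y [mod m ] → y ≡ x [mod m ]
    ≡[mod]-sym {x} {y} x≡y = unsigned (subst (m DS.∣_) (neg-sub x y) (DS.∣m⇒∣-m (signed x≡y)))
      where
        neg-sub : ∀ x y → - (x - y) ≡ y - x
        neg-sub = solve-∀

    ≡[mod]-trans : ∀ {x y z} → x ≡ y [mod m ] → y ≡ z [mod m ] → x ≡ z [mod m ]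
    ≡[mod]-trans {x} {y} {z} x≡y y≡z =
      unsigned (subst (m DS.∣_) (telescope x y z) (DS.∣m∣n⇒∣m+n (signed x≡y) (signed y≡z)))
      where
        telescope : ∀ x y z → (x - y) + (y - z) ≡ x - z
        telescope = solve-∀

    +-*-≡[mod] : ∀ x k → x + k * m ≡ x [mod m ]
    +-*-≡[mod] x k = ≡[mod]-byMultiple k (cancel x k m)
      where
        cancel : ∀ x k m → x + k * m - x ≡ k * m
        cancel = solve-∀

  ∣∧<⇒≡0 : ∀ {m n} → m NDv.∣ n → n ℕ.< m → n ≡ 0
  ∣∧<⇒≡0 {n = zero}  _   _   = refl
  ∣∧<⇒≡0 {n = suc _} m∣n n<m = ⊥-elim (NDv.>⇒∤ n<m m∣n)

  ≡[mod]-window-≤ : ∀ {c x y} m → c ≤ y → x < c + + m → y ≤ x → x ≡ y [mod + m ] → x ≡ y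
  ≡[mod]-window-≤ {c} {x} {y} m c≤y x<c+m y≤x x≡y = ℤP.i-j≡0⇒i≡j x y (begin
    x - y        ≡⟨ ℤP.0≤i⇒+∣i∣≡i (ℤP.i≤j⇒0≤j-i y≤x) ⟨
    + ∣ x - y ∣  ≡⟨ cong +_ (∣∧<⇒≡0 (divides x≡y) (ℤP.drop‿+<+ ∣x-y∣<m)) ⟩
    + 0          ∎)
    where
      open ≡-Reasoning
      split : ∀ c m x y → m - (x - y) ≡ ((c + m - x - + 1) + (y - c)) + + 1
      split = solve-∀
      ∣x-y∣<m : + ∣ x - y ∣ < + m
      ∣x-y∣<m = subst (_< + m) (sym (ℤP.0≤i⇒+∣i∣≡i (ℤP.i≤j⇒0≤j-i y≤x)))
        (<-byDiff (ℤP.+-mono-≤ (i<j⇒0≤j-i-1 x<c+m) (ℤP.i≤j⇒0≤j-i c≤y)) (split c (+ m) x y))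

  ≡[mod]-window : ∀ {c x y} m → c ≤ x → x < c + + m → c ≤ y → y < c + + m → x ≡ y [mod + m ] → x ≡ y
  ≡[mod]-window {x = x} {y} m c≤x x<c+m c≤y y<c+m x≡y with ℤP.≤-total y x
  ... | inj₁ y≤x = ≡[mod]-window-≤ m c≤y x<c+m y≤x x≡y
  ... | inj₂ x≤y = sym (≡[mod]-window-≤ m c≤x y<c+m x≤y (≡[mod]-sym x≡y))

  -- Sumsets

  module _ {Γ : List ℤ} where

    Sumset-zero⇒≡0 : ∀ {x} → Sumset Γ 0 x → x ≡ + 0
    Sumset-zero⇒≡0 sum-zero = refl

    Sumset-single : ∀ {g} → g ∈ Γ → Sumset Γ 1 g
    Sumset-single {g} g∈Γ = subst (Sumset Γ 1) (ℤP.+-identityʳ g) (sum-step g∈Γ sum-zero)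

    Sumset-+ : ∀ {i j x y} → Sumset Γ i x → Sumset Γ j y → Sumset Γ (i ℕ.+ j) (x + y)
    Sumset-+ {y = y} sum-zero t = subst (Sumset Γ _) (sym (ℤP.+-identityˡ y)) t
    Sumset-+ {y = y} (sum-step {a = a} {x = x} a∈Γ s) t =
      subst (Sumset Γ _) (sym (ℤP.+-assoc a x y)) (sum-step a∈Γ (Sumset-+ s t))

    Sumset-split : ∀ i {j x} → Sumset Γ (i ℕ.+ j) x →
                   ∃[ y ] ∃[ z ] (Sumset Γ i y × Sumset Γ j z × x ≡ y + z)
    Sumset-split zero    {x = x} s = + 0 , x , sum-zero , s , sym (ℤP.+-identityˡ x)
    Sumset-split (suc i) (sum-step {a = a} a∈Γ s) with Sumset-split i s
    ... | y , z , sy , sz , refl = a + y , z , sum-step a∈Γ sy , sz , sym (ℤP.+-assoc a y z)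

    Sumset-replicate : ∀ {g} → g ∈ Γ → ∀ k → Sumset Γ k (+ k * g)
    Sumset-replicate {g} g∈Γ zero    = subst (Sumset Γ 0) (sym (ℤP.*-zeroˡ g)) sum-zero
    Sumset-replicate {g} g∈Γ (suc k) =
      subst (Sumset Γ (suc k)) (sym (ℤP.suc-* (+ k) g)) (sum-step g∈Γ (Sumset-replicate g∈Γ k))

  Sumset-⊆ : ∀ {Γ Δ} → Γ ⊆ Δ → ∀ {i x} → Sumset Γ i x → Sumset Δ i x
  Sumset-⊆ Γ⊆Δ sum-zero         = sum-zero
  Sumset-⊆ Γ⊆Δ (sum-step a∈Γ s) = sum-step (Γ⊆Δ a∈Γ) (Sumset-⊆ Γ⊆Δ s)

  Sumset-∷-suc⁻ : ∀ {g Γ i x} → Sumset (g ∷ Γ) (suc i) x →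
                  (∃[ y ] (x ≡ g + y × Sumset (g ∷ Γ) i y)) ⊎ Sumset Γ (suc i) x
  Sumset-∷-suc⁻ (sum-step (here refl) s)                   = inj₁ (_ , refl , s)
  Sumset-∷-suc⁻ {i = zero} (sum-step (there a∈Γ) sum-zero) = inj₂ (sum-step a∈Γ sum-zero)
  Sumset-∷-suc⁻ {g} {i = suc i} (sum-step {a = a} (there a∈Γ) s) with Sumset-∷-suc⁻ s
  ... | inj₁ (y , refl , t) = inj₁ (a + y , +-left-comm a g y , sum-step (there a∈Γ) t)
    where
      +-left-comm : ∀ a g y → a + (g + y) ≡ g + (a + y)
      +-left-comm = solve-∀
  ... | inj₂ t              = inj₂ (sum-step a∈Γ t)

  module _ (t : ℤ) where

    private
      shift : ∀ a x i t → a + t + (x + i * t) ≡ a + x + (+ 1 + i) * t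
      shift = solve-∀

    Sumset-map-+⁺ : ∀ {Γ i x} → Sumset Γ i x → Sumset (map (_+ t) Γ) i (x + + i * t)
    Sumset-map-+⁺ sum-zero = subst (Sumset _ 0) (sym (ℤP.*-zeroˡ t)) sum-zero
    Sumset-map-+⁺ {i = suc i} (sum-step {a = a} {x = x} a∈Γ s) =
      subst (Sumset _ (suc i)) (shift a x (+ i) t) (sum-step (∈-map⁺ (_+ t) a∈Γ) (Sumset-map-+⁺ s))

    Sumset-map-+⁻ : ∀ {Γ i y} → Sumset (map (_+ t) Γ) i y → ∃[ x ] (Sumset Γ i x × y ≡ x + + i * t)
    Sumset-map-+⁻ sum-zero = + 0 , sum-zero , sym (ℤP.*-zeroˡ t)
    Sumset-map-+⁻ {i = suc i} (sum-step b∈Γ+t s) with ∈-map⁻ (_+ t) b∈Γ+t | Sumset-map-+⁻ s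
    ... | a , a∈Γ , refl | x , sx , refl = a + x , sum-step a∈Γ sx , shift a x (+ i) t

  -- One entry per multiset of i elements of Γ, so that Γ is a B_h set iff sums Γ h is duplicate-free.

  sums : List ℤ → ℕ → List ℤ
  sums _       zero    = + 0 ∷ []
  sums []      (suc i) = []
  sums (g ∷ Γ) (suc i) = map (_+_ g) (sums (g ∷ Γ) i) ++ sums Γ (suc i)

  ∈-sums⁻ : ∀ Γ i {x} → x ∈ sums Γ i → Sumset Γ i x
  ∈-sums⁻ Γ       zero    (here refl) = sum-zero
  ∈-sums⁻ (g ∷ Γ) (suc i) p = [
      (λ q → let y , y∈ , x≡g+y = ∈-map⁻ (_+_ g) q in
        subst (Sumset (g ∷ Γ) (suc i)) (sym x≡g+y) (sum-step (here refl) (∈-sums⁻ (g ∷ Γ) i y∈))) ,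
      (λ q → Sumset-⊆ there (∈-sums⁻ Γ (suc i) q)) ]′
    (∈-++⁻ (map (_+_ g) (sums (g ∷ Γ) i)) p)

  ∈-sums⁺ : ∀ Γ i {x} → Sumset Γ i x → x ∈ sums Γ i
  ∈-sums⁺ Γ       zero    sum-zero        = here refl
  ∈-sums⁺ []      (suc i) (sum-step () _)
  ∈-sums⁺ (g ∷ Γ) (suc i) s = [
      (λ (y , x≡g+y , t) → subst (_∈ sums (g ∷ Γ) (suc i)) (sym x≡g+y)
        (∈-++⁺ˡ (∈-map⁺ (_+_ g) (∈-sums⁺ (g ∷ Γ) i t)))) ,
      (λ t → ∈-++⁺ʳ (map (_+_ g) (sums (g ∷ Γ) i)) (∈-sums⁺ Γ (suc i) t)) ]′
    (Sumset-∷-suc⁻ s)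

  length-sums : ∀ Γ i → length (sums Γ i) ≡ multichoose (length Γ) i
  length-sums Γ       zero    = refl
  length-sums []      (suc i) = refl
  length-sums (g ∷ Γ) (suc i) = begin
    length (map (_+_ g) (sums (g ∷ Γ) i) ++ sums Γ (suc i))
      ≡⟨ length-++ (map (_+_ g) (sums (g ∷ Γ) i)) ⟩
    length (map (_+_ g) (sums (g ∷ Γ) i)) ℕ.+ length (sums Γ (suc i))
      ≡⟨ cong₂ ℕ._+_ (trans (length-map (_+_ g) (sums (g ∷ Γ) i)) (length-sums (g ∷ Γ) i))
                     (length-sums Γ (suc i)) ⟩
    multichoose (suc (length Γ)) i ℕ.+ multichoose (length Γ) (suc i)   ∎
    where open ≡-Reasoning

  sums-map-+ : ∀ t Γ i → sums (map (_+ t) Γ) i ≡ map (_+ + i * t) (sums Γ i)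
  sums-map-+ t Γ       zero    = cong (_∷ []) (sym (ℤP.*-zeroˡ t))
  sums-map-+ t []      (suc i) = refl
  sums-map-+ t (g ∷ Γ) (suc i) = begin
    map (_+_ (g + t)) (sums (map (_+ t) (g ∷ Γ)) i) ++ sums (map (_+ t) Γ) (suc i)
      ≡⟨ cong₂ _++_ (cong (map (_+_ (g + t))) (sums-map-+ t (g ∷ Γ) i)) (sums-map-+ t Γ (suc i)) ⟩
    map (_+_ (g + t)) (map (_+ + i * t) (sums (g ∷ Γ) i)) ++ map (_+ + suc i * t) (sums Γ (suc i))
      ≡⟨ cong (_++ _) (trans (sym (map-∘ (sums (g ∷ Γ) i))) (map-cong shift (sums (g ∷ Γ) i))) ⟩
    map ((_+ + suc i * t) ∘ (_+_ g)) (sums (g ∷ Γ) i) ++ map (_+ + suc i * t) (sums Γ (suc i))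
      ≡⟨ cong (_++ _) (map-∘ (sums (g ∷ Γ) i)) ⟩
    map (_+ + suc i * t) (map (_+_ g) (sums (g ∷ Γ) i)) ++ map (_+ + suc i * t) (sums Γ (suc i))
      ≡⟨ map-++ (_+ + suc i * t) (map (_+_ g) (sums (g ∷ Γ) i)) (sums Γ (suc i)) ⟨
    map (_+ + suc i * t) (sums (g ∷ Γ) (suc i))   ∎
    where
      open ≡-Reasoning
      regroup : ∀ g t x i → g + t + (x + i * t) ≡ g + x + (+ 1 + i) * t
      regroup = solve-∀
      shift : ∀ x → g + t + (x + + i * t) ≡ g + x + + suc i * t
      shift x = regroup g t x (+ i)

  Unique-sums-pred : ∀ Γ i → Unique (sums Γ (suc i)) → Unique (sums Γ i)
  Unique-sums-pred []      zero    _ = All.[] ∷ []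
  Unique-sums-pred []      (suc i) _ = []
  Unique-sums-pred (g ∷ Γ) i       u = UP.map⁻ (Unique-++⁻ˡ _ u)

  Unique-sums-≤ : ∀ Γ {i j} → i ℕ.≤ j → Unique (sums Γ j) → Unique (sums Γ i)
  Unique-sums-≤ Γ i≤j = go (ℕP.≤⇒≤′ i≤j)
    where
      go : ∀ {i j} → i ℕ.≤′ j → Unique (sums Γ j) → Unique (sums Γ i)
      go ℕ.≤′-refl        u = u
      go (ℕ.≤′-step i≤′j) u = go i≤′j (Unique-sums-pred Γ _ u)

  sumsBelow : List ℤ → ℕ → List ℤ
  sumsBelow Γ zero    = []
  sumsBelow Γ (suc k) = sumsBelow Γ k ++ sums Γ k

  ∈-sumsBelow⁻ : ∀ Γ k {x} → x ∈ sumsBelow Γ k → ∃[ i ] (i ℕ.< k × Sumset Γ i x)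
  ∈-sumsBelow⁻ Γ (suc k) p with ∈-++⁻ (sumsBelow Γ k) p
  ... | inj₁ q = let i , i<k , s = ∈-sumsBelow⁻ Γ k q in i , ℕP.m<n⇒m<1+n i<k , s
  ... | inj₂ q = k , ℕP.n<1+n k , ∈-sums⁻ Γ k q

  ∈-sumsBelow⁺ : ∀ Γ {k i x} → i ℕ.< k → Sumset Γ i x → x ∈ sumsBelow Γ k
  ∈-sumsBelow⁺ Γ {suc k} {i} i<1+k s with i ℕ.≟ k
  ... | yes refl = ∈-++⁺ʳ (sumsBelow Γ k) (∈-sums⁺ Γ i s)
  ... | no i≢k   = ∈-++⁺ˡ (∈-sumsBelow⁺ Γ (ℕP.≤∧≢⇒< (ℕP.≤-pred i<1+k) i≢k) s)

  length-sumsBelow : ∀ Γ k → length (sumsBelow Γ k) ≡ sumBelow k (λ i → length (sums Γ i))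
  length-sumsBelow Γ zero    = refl
  length-sumsBelow Γ (suc k) =
    trans (length-++ (sumsBelow Γ k)) (cong (ℕ._+ length (sums Γ k)) (length-sumsBelow Γ k))

  sum-map-sumsBelow : ∀ (f : ℤ → ℕ) Γ k →
                      sum (map f (sumsBelow Γ k)) ≡ sumBelow k (λ i → sum (map f (sums Γ i)))
  sum-map-sumsBelow f Γ zero    = refl
  sum-map-sumsBelow f Γ (suc k) = begin
    sum (map f (sumsBelow Γ k ++ sums Γ k))                 ≡⟨ cong sum (map-++ f (sumsBelow Γ k) (sums Γ k)) ⟩
    sum (map f (sumsBelow Γ k) ++ map f (sums Γ k))         ≡⟨ sum-++ (map f (sumsBelow Γ k)) (map f (sums Γ k)) ⟩
    sum (map f (sumsBelow Γ k)) ℕ.+ sum (map f (sums Γ k))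
      ≡⟨ cong (ℕ._+ sum (map f (sums Γ k))) (sum-map-sumsBelow f Γ k) ⟩
    sumBelow (suc k) (λ i → sum (map f (sums Γ i)))         ∎
    where open ≡-Reasoning

  Card-bijection : ∀ {P Q : ℤ → Set} {n} (f g : ℤ → ℤ) → (∀ x → g (f x) ≡ x) → (∀ y → f (g y) ≡ y) →
                   (∀ {x} → P x → Q (f x)) → (∀ {y} → Q y → P (g y)) → Card P n → Card Q n
  Card-bijection {P} {Q} f g g∘f f∘g P⇒Q Q⇒P (L , L-unique , L⇔P , L-length) =
    map f L , UP.map⁺ f-injective L-unique , (λ y → mk⇔ (sound y) complete) , trans (length-map f L) L-length
    where
      f-injective : ∀ {x y} → f x ≡ f y → x ≡ y
      f-injective {x} {y} fx≡fy = trans (sym (g∘f x)) (trans (cong g fx≡fy) (g∘f y))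
      sound : ∀ y → y ∈ map f L → Q y
      sound y p with x , x∈L , refl ← ∈-map⁻ f p = P⇒Q (Equivalence.to (L⇔P x) x∈L)
      complete : ∀ {y} → Q y → y ∈ map f L
      complete {y} q = subst (_∈ map f L) (f∘g y) (∈-map⁺ f (Equivalence.from (L⇔P (g y)) (Q⇒P q)))

  module _ (h : ℕ) (t : ℤ) (Γ : List ℤ) where

    private
      ∈-map-+⁻ : ∀ {y} → y ∈ map (_+ t) Γ → y - t ∈ Γ
      ∈-map-+⁻ p with x , x∈Γ , refl ← ∈-map⁻ (_+ t) p = subst (_∈ Γ) (sym (i+j-j≡i x t)) x∈Γ

      Sumset-map-+-h⁻ : ∀ {y} → Sumset (map (_+ t) Γ) h y → Sumset Γ h (y - + h * t)
      Sumset-map-+-h⁻ s with x , sx , refl ← Sumset-map-+⁻ t s =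
        subst (Sumset Γ h) (sym (i+j-j≡i x (+ h * t))) sx

      Card-translate : ∀ {P Q : ℤ → Set} {n} u →
                       (∀ {x} → P x → Q (x + u)) → (∀ {y} → Q y → P (y - u)) → Card P n → Card Q n
      Card-translate u = Card-bijection (_+ u) (_- u) (λ x → i+j-j≡i x u) (λ y → i-j+j≡i y u)

      Card-untranslate : ∀ {P Q : ℤ → Set} {n} u →
                         (∀ {x} → P x → Q (x - u)) → (∀ {y} → Q y → P (y + u)) → Card P n → Card Q n
      Card-untranslate u = Card-bijection (_- u) (_+ u) (λ x → i-j+j≡i x u) (λ y → i+j-j≡i y u)

    IsBh-map-+ : IsBh h (map (_+ t) Γ) ⇔ IsBh h Γ
    IsBh-map-+ = mk⇔
      (λ (n , card-Γ , card-hΓ) → n , Card-untranslate t ∈-map-+⁻ (∈-map⁺ (_+ t)) card-Γ ,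
                                      Card-untranslate (+ h * t) Sumset-map-+-h⁻ (Sumset-map-+⁺ t) card-hΓ)
      (λ (n , card-Γ , card-hΓ) → n , Card-translate t (∈-map⁺ (_+ t)) ∈-map-+⁻ card-Γ ,
                                      Card-translate (+ h * t) (Sumset-map-+⁺ t) Sumset-map-+-h⁻ card-hΓ)

  CollisionFree-map-+ : ∀ h m Γ → CollisionFree h m (map (_+ m) Γ) ⇔ CollisionFree h m Γ
  CollisionFree-map-+ h m Γ = mk⇔
    (λ (bh , disjoint) → Equivalence.to   (IsBh-map-+ h m Γ) bh , disjoint⁻ disjoint)
    (λ (bh , disjoint) → Equivalence.from (IsBh-map-+ h m Γ) bh , disjoint⁺ disjoint)
    where
      DisjointMod : List ℤ → Set
      DisjointMod Δ =
        ∀ i j → i ℕ.≤ h → j ℕ.≤ h → i ≢ j → ∀ x y → Sumset Δ i x → Sumset Δ j y → ¬ (m ∣ (x - y))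
      shift : ∀ x y i j m → x + i * m - (y + j * m) ≡ (x - y) + (i - j) * m
      shift = solve-∀
      unshift : ∀ x y i j m → x - y ≡ (x + i * m - (y + j * m)) + (j - i) * m
      unshift = solve-∀
      disjoint⁻ : DisjointMod (map (_+ m) Γ) → DisjointMod Γ
      disjoint⁻ disjoint i j i≤h j≤h i≢j x y sx sy m∣x-y =
        disjoint i j i≤h j≤h i≢j _ _ (Sumset-map-+⁺ m sx) (Sumset-map-+⁺ m sy)
          (divides (≡[mod]-byDiff {x′ = x + + i * m} {y + + j * m} (+ i - + j)
            (mod-divides {x} {y} m∣x-y) (shift x y (+ i) (+ j) m)))
      disjoint⁺ : DisjointMod Γ → DisjointMod (map (_+ m) Γ)
      disjoint⁺ disjoint i j i≤h j≤h i≢j _ _ sx′ sy′ m∣x′-y′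
        with x , sx , refl ← Sumset-map-+⁻ m sx′ | y , sy , refl ← Sumset-map-+⁻ m sy′ =
        disjoint i j i≤h j≤h i≢j x y sx sy
          (divides (≡[mod]-byDiff {x′ = x} {y} (+ j - + i)
            (mod-divides {x + + i * m} {y + + j * m} m∣x′-y′) (unshift x y (+ i) (+ j) m)))

  -- The semigroup ⟨m, Γ⟩_c under the standing assumptions

  -- The parts of Defs.Standing that are used, with m as a natural number; γ₀ (the minimum γ₁ of Γ
  -- there) pads sums of fewer than h generators up to h.

  record StandingAssumptions (h m : ℕ) (c : ℤ) (Γ : List ℤ) : Set where
    field
      1<h      : 1 ℕ.< h
      m<c      : + m < c
      Γ-unique : Unique Γ
      γ₀       : ℤ
      γ₀∈Γ     : γ₀ ∈ Γ
      m<γ      : ∀ {γ} → γ ∈ Γ → + m < γ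
      c≤hγ     : ∀ {γ} → γ ∈ Γ → c ≤ + h * γ
      hγ<c+m   : ∀ {γ} → γ ∈ Γ → + h * γ < c + + m

  module NumericalSemigroup {h m c Γ} .{{_ : NonZero m}} (sa : StandingAssumptions h m c Γ) where
    open StandingAssumptions sa

    0<m : + 0 < + m
    0<m = +<+ (ℕ.>-nonZero⁻¹ m)

    c<c+m : c < c + + m
    c<c+m = subst (_< c + + m) (ℤP.+-identityʳ c) (ℤP.+-monoʳ-< c 0<m)

    Sumset-nonneg : ∀ {i x} → Sumset Γ i x → + 0 ≤ x
    Sumset-nonneg sum-zero         = ℤP.≤-refl
    Sumset-nonneg (sum-step a∈Γ s) = ℤP.+-mono-≤ (ℤP.<⇒≤ (ℤP.<-trans 0<m (m<γ a∈Γ))) (Sumset-nonneg s)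

    Sumset-suc-> : ∀ {i x} → Sumset Γ (suc i) x → + m < x
    Sumset-suc-> (sum-step a∈Γ s) = ℤP.<-≤-trans (m<γ a∈Γ) (0≤j⇒i≤i+j (Sumset-nonneg s))

    hγ≤c+m-1 : ∀ {γ} → γ ∈ Γ → + h * γ ≤ c + + m - + 1
    hγ≤c+m-1 {γ} γ∈Γ = ≤-byDiff (i<j⇒0≤j-i-1 (hγ<c+m γ∈Γ)) (reorder c (+ m) (+ h * γ))
      where
        reorder : ∀ c m y → c + m - + 1 - y ≡ c + m - y - + 1
        reorder = solve-∀

    Sumset-bounds : ∀ {i x} → Sumset Γ i x → (+ i * c ≤ + h * x) × (+ h * x ≤ + i * (c + + m - + 1))
    Sumset-bounds sum-zero =
      ℤP.≤-reflexive (sym (ℤP.*-zeroʳ (+ h))) , ℤP.≤-reflexive (ℤP.*-zeroʳ (+ h))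
    Sumset-bounds {suc i} (sum-step {a = a} {x = x} a∈Γ s) =
      let lower , upper = Sumset-bounds s in
      subst₂ _≤_ (sym (ℤP.suc-* (+ i) c)) (sym h*[a+x]) (ℤP.+-mono-≤ (c≤hγ a∈Γ) lower) ,
      subst₂ _≤_ (sym h*[a+x]) (sym (ℤP.suc-* (+ i) _)) (ℤP.+-mono-≤ (hγ≤c+m-1 a∈Γ) upper)
      where h*[a+x] = ℤP.*-distribˡ-+ (+ h) a x

    Sumset-h-window : ∀ {x} → Sumset Γ h x → (c ≤ x) × (x < c + + m)
    Sumset-h-window {x} s =
      let lower , upper = Sumset-bounds s in
      ℤP.*-cancelˡ-≤-pos c x (+ h) lower ,
      <-byDiff (ℤP.i≤j⇒0≤j-i (ℤP.*-cancelˡ-≤-pos x _ (+ h) upper)) (reorder c (+ m) x)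
      where
        instance
          +h-positive : ℤ.Positive (+ h)
          +h-positive = ℤ.positive (+<+ (ℕP.<-trans (s≤s z≤n) 1<h))
        reorder : ∀ c m x → c + m - x ≡ (c + m - + 1 - x) + + 1
        reorder = solve-∀

    Sumset-pad : ∀ {i x} → Sumset Γ i x → i ℕ.≤ h → Sumset Γ h (x + + (h ℕ.∸ i) * γ₀)
    Sumset-pad {i} {x} s i≤h = subst (λ k → Sumset Γ k (x + + (h ℕ.∸ i) * γ₀)) (ℕP.m+[n∸m]≡n i≤h)
                                     (Sumset-+ s (Sumset-replicate γ₀∈Γ (h ℕ.∸ i)))

    Sumset-<c+m : ∀ {i x} → Sumset Γ i x → i ℕ.≤ h → x < c + + m
    Sumset-<c+m {i} s i≤h = ℤP.≤-<-trans (0≤j⇒i≤i+j (Sumset-nonneg (Sumset-replicate γ₀∈Γ (h ℕ.∸ i))))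
                                         (proj₂ (Sumset-h-window (Sumset-pad s i≤h)))

    Sumset-<c : ∀ {i x} → Sumset Γ i x → i ℕ.< h → x < c
    Sumset-<c {i} {x} s i<h = <-byDiff
      (ℤP.+-mono-≤ (ℤP.+-mono-≤ (i<j⇒0≤j-i-1 x+pad<c+m) (i<j⇒0≤j-i-1 m<pad)) (+≤+ z≤n))
      (reorder c (+ m) x pad)
      where
        pad = + (h ℕ.∸ i) * γ₀
        x+pad<c+m = proj₂ (Sumset-h-window (Sumset-pad s (ℕP.<⇒≤ i<h)))
        m<pad : + m < pad
        m<pad = Sumset-suc-> (subst (λ k → Sumset Γ k pad) (ℕP.+-∸-assoc 1 i<h)
                                    (Sumset-replicate γ₀∈Γ (h ℕ.∸ i)))
        reorder : ∀ c m x w → c - x ≡ ((c + m - (x + w) - + 1) + (w - m - + 1) + + 1) + + 1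
        reorder = solve-∀

    Sumset-≥c : ∀ {i x} → Sumset Γ i x → h ℕ.≤ i → c ≤ x
    Sumset-≥c {i} {x} s h≤i with Sumset-split h (subst (λ k → Sumset Γ k x) (sym (ℕP.m+[n∸m]≡n h≤i)) s)
    ... | y , z , sy , sz , refl = ℤP.≤-trans (proj₁ (Sumset-h-window sy)) (0≤j⇒i≤i+j (Sumset-nonneg sz))

    Sumset->c+m : ∀ {i x} → Sumset Γ i x → h ℕ.< i → c + + m < x
    Sumset->c+m {i} {x} s h<i
      with Sumset-split h (subst (λ k → Sumset Γ k x) (sym (ℕP.m+[n∸m]≡n (ℕP.<⇒≤ h<i))) s)
    ... | y , z , sy , sz , refl = ℤP.+-mono-≤-< (proj₁ (Sumset-h-window sy))
                                     (Sumset-suc-> (subst (λ k → Sumset Γ k z) (ℕP.+-∸-assoc 1 h<i) sz))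

    Sumset-≡[mod]⇒≡ : ∀ {i x y} → Sumset Γ i x → Sumset Γ i y → i ℕ.≤ h → x ≡ y [mod + m ] → x ≡ y
    Sumset-≡[mod]⇒≡ {i} {x} {y} sx sy i≤h x≡y = +-cancelʳ pad x y
      (≡[mod]-window m c≤x+pad x+pad<c+m c≤y+pad y+pad<c+m (≡[mod]-byDiff (+ 0) x≡y (reorder x y pad (+ m))))
      where
        pad = + (h ℕ.∸ i) * γ₀
        reorder : ∀ x y w m → x + w - (y + w) ≡ (x - y) + + 0 * m
        reorder = solve-∀
        c≤x+pad   = proj₁ (Sumset-h-window (Sumset-pad sx i≤h))
        x+pad<c+m = proj₂ (Sumset-h-window (Sumset-pad sx i≤h))
        c≤y+pad   = proj₁ (Sumset-h-window (Sumset-pad sy i≤h))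
        y+pad<c+m = proj₂ (Sumset-h-window (Sumset-pad sy i≤h))

    S : ℤ → Set
    S = InS (+ m) Γ c

    Decomposable : ℤ → Set
    Decomposable y = ∃[ u ] ∃[ v ] (u ≢ + 0 × v ≢ + 0 × S u × S v × y ≡ u + v)

    record Rep (y : ℤ) : Set where
      constructor rep
      field
        size mult : ℕ
        base      : ℤ
        sumset    : Sumset Γ size base
        y≡        : y ≡ base + + mult * + m

    weight : ∀ {y} → Rep y → ℕ
    weight r = Rep.size r ℕ.+ Rep.mult r

    Sumset⇒InS : ∀ {i x} → Sumset Γ i x → S x
    Sumset⇒InS sum-zero         = s-zero
    Sumset⇒InS (sum-step a∈Γ s) = s-add (s-Γ a∈Γ) (Sumset⇒InS s)

    multiple-InS : ∀ j → S (+ j * + m)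
    multiple-InS zero    = s-zero
    multiple-InS (suc j) = subst S (sym (ℤP.suc-* (+ j) (+ m))) (s-add s-m (multiple-InS j))

    Rep⇒InS : ∀ {y} → Rep y → S y
    Rep⇒InS (rep i j x s refl) = s-add (Sumset⇒InS s) (multiple-InS j)

    Rep-+ : ∀ {u v} → Rep u → Rep v → Rep (u + v)
    Rep-+ (rep i j x s refl) (rep i′ j′ x′ s′ refl) = rep (i ℕ.+ i′) (j ℕ.+ j′) (x + x′) (Sumset-+ s s′)
      (trans (regroup x x′ (+ j) (+ j′) (+ m)) (cong (λ k → x + x′ + k * + m) (sym (ℤP.pos-+ j j′))))
      where
        regroup : ∀ x x′ j j′ m → x + j * m + (x′ + j′ * m) ≡ x + x′ + (j + j′) * m
        regroup = solve-∀

    weight-Rep-+ : ∀ {u v} (ru : Rep u) (rv : Rep v) → weight (Rep-+ ru rv) ≡ weight ru ℕ.+ weight rv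
    weight-Rep-+ (rep i j _ _ refl) (rep i′ j′ _ _ refl) = +-interchange i i′ j j′

    InS-nonneg : ∀ {y} → S y → + 0 ≤ y
    InS-nonneg s-zero      = ℤP.≤-refl
    InS-nonneg s-m         = ℤP.<⇒≤ 0<m
    InS-nonneg (s-Γ γ∈Γ)   = ℤP.<⇒≤ (ℤP.<-trans 0<m (m<γ γ∈Γ))
    InS-nonneg (s-c c≤y)   = ℤP.≤-trans (ℤP.<⇒≤ (ℤP.<-trans 0<m m<c)) c≤y
    InS-nonneg (s-add u v) = ℤP.+-mono-≤ (InS-nonneg u) (InS-nonneg v)

    ≤-+-multiple : ∀ x j → x ≤ x + + j * + m
    ≤-+-multiple x j = 0≤j⇒i≤i+j (InS-nonneg (multiple-InS j))

    InS⇒≥c⊎Rep : ∀ {y} → S y → c ≤ y ⊎ Rep y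
    InS⇒≥c⊎Rep s-zero        = inj₂ (rep 0 0 (+ 0) sum-zero refl)
    InS⇒≥c⊎Rep s-m           =
      inj₂ (rep 0 1 (+ 0) sum-zero (sym (trans (ℤP.+-identityˡ _) (ℤP.*-identityˡ (+ m)))))
    InS⇒≥c⊎Rep (s-Γ {γ} γ∈Γ) = inj₂ (rep 1 0 γ (Sumset-single γ∈Γ) (sym (ℤP.+-identityʳ γ)))
    InS⇒≥c⊎Rep (s-c c≤y)     = inj₁ c≤y
    InS⇒≥c⊎Rep (s-add {u} {v} su sv) with InS⇒≥c⊎Rep su | InS⇒≥c⊎Rep sv
    ... | inj₁ c≤u | _        = inj₁ (ℤP.≤-trans c≤u (0≤j⇒i≤i+j (InS-nonneg sv)))
    ... | inj₂ _   | inj₁ c≤v =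
      inj₁ (ℤP.≤-trans c≤v (subst (v ≤_) (ℤP.+-comm v u) (0≤j⇒i≤i+j (InS-nonneg su))))
    ... | inj₂ ru  | inj₂ rv  = inj₂ (Rep-+ ru rv)

    ≥m⇒≢0 : ∀ {y} → + m ≤ y → y ≢ + 0
    ≥m⇒≢0 m≤y refl = ℤP.<-irrefl refl (ℤP.<-≤-trans 0<m m≤y)

    Rep-weight≥1⇒≥m : ∀ {y} (r : Rep y) → 1 ℕ.≤ weight r → + m ≤ y
    Rep-weight≥1⇒≥m (rep (suc i) j x s refl) _ = ℤP.≤-trans (ℤP.<⇒≤ (Sumset-suc-> s)) (≤-+-multiple x j)
    Rep-weight≥1⇒≥m (rep zero (suc j) x s refl) _ = subst (+ m ≤_) (sym x+[1+j]m≡m+jm) (≤-+-multiple (+ m) j)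
      where
        x+[1+j]m≡m+jm : x + + suc j * + m ≡ + m + + j * + m
        x+[1+j]m≡m+jm = trans (cong (_+ + suc j * + m) (Sumset-zero⇒≡0 s))
                              (trans (ℤP.+-identityˡ _) (ℤP.suc-* (+ j) (+ m)))

    Rep-≢0⇒weight≥1 : ∀ {y} (r : Rep y) → y ≢ + 0 → 1 ℕ.≤ weight r
    Rep-≢0⇒weight≥1 (rep zero    zero    x s refl) y≢0 =
      ⊥-elim (y≢0 (trans (ℤP.+-identityʳ x) (Sumset-zero⇒≡0 s)))
    Rep-≢0⇒weight≥1 (rep zero    (suc j) x s refl) _   = s≤s z≤n
    Rep-≢0⇒weight≥1 (rep (suc i) j       x s refl) _   = s≤s z≤n

    InS-≢0⇒≥m : ∀ {y} → S y → y ≢ + 0 → + m ≤ y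
    InS-≢0⇒≥m s y≢0 with InS⇒≥c⊎Rep s
    ... | inj₁ c≤y = ℤP.≤-trans (ℤP.<⇒≤ m<c) c≤y
    ... | inj₂ r   = Rep-weight≥1⇒≥m r (Rep-≢0⇒weight≥1 r y≢0)

    Rep-heavy⇒Decomposable : ∀ {y} (r : Rep y) → 2 ℕ.≤ weight r → Decomposable y
    Rep-heavy⇒Decomposable (rep i (suc j) x s refl) 2≤w =
      + m , x + + j * + m , ≥m⇒≢0 ℤP.≤-refl , ≥m⇒≢0 (Rep-weight≥1⇒≥m (rep i j x s refl) 1≤i+j) ,
      s-m , Rep⇒InS (rep i j x s refl) , regroup x (+ j) (+ m)
      where
        1≤i+j : 1 ℕ.≤ i ℕ.+ j
        1≤i+j = ℕP.≤-pred (subst (2 ℕ.≤_) (ℕP.+-suc i j) 2≤w)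
        regroup : ∀ x j m → x + (+ 1 + j) * m ≡ m + (x + j * m)
        regroup = solve-∀
    Rep-heavy⇒Decomposable (rep (suc (suc i)) zero _ (sum-step {a = a} {x = x} a∈Γ s) refl) _ =
      a , x , ≥m⇒≢0 (ℤP.<⇒≤ (m<γ a∈Γ)) , ≥m⇒≢0 (ℤP.<⇒≤ (Sumset-suc-> s)) ,
      s-Γ a∈Γ , Sumset⇒InS s , ℤP.+-identityʳ (a + x)
    Rep-heavy⇒Decomposable (rep zero       zero _ _ refl) ()
    Rep-heavy⇒Decomposable (rep (suc zero) zero _ _ refl) (s≤s ())

    Decomposable⇒heavyRep : ∀ {y} → y < c + + m → Decomposable y → Σ (Rep y) (λ r → 2 ℕ.≤ weight r)
    Decomposable⇒heavyRep y<c+m (u , v , u≢0 , v≢0 , su , sv , refl) with InS⇒≥c⊎Rep su | InS⇒≥c⊎Rep sv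
    ... | inj₁ c≤u | _        = ⊥-elim (ℤP.<⇒≱ y<c+m (ℤP.+-mono-≤ c≤u (InS-≢0⇒≥m sv v≢0)))
    ... | inj₂ _   | inj₁ c≤v = ⊥-elim (ℤP.<⇒≱ y<c+m
      (subst (c + + m ≤_) (ℤP.+-comm v u) (ℤP.+-mono-≤ c≤v (InS-≢0⇒≥m su u≢0))))
    ... | inj₂ ru  | inj₂ rv  = Rep-+ ru rv , subst (2 ℕ.≤_) (sym (weight-Rep-+ ru rv))
      (ℕP.+-mono-≤ (Rep-≢0⇒weight≥1 ru u≢0) (Rep-≢0⇒weight≥1 rv v≢0))

    Primitive⇒<c+m : ∀ {y} → Primitive (+ m) Γ c y → y < c + + m
    Primitive⇒<c+m {y} (_ , _ , indecomposable) = ℤP.≰⇒> λ c+m≤y →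
      let c≤y-m = ≤-byDiff (ℤP.i≤j⇒0≤j-i c+m≤y) (reorder c (+ m) y) in
      indecomposable (+ m , y - + m , ≥m⇒≢0 ℤP.≤-refl ,
                      ≥m⇒≢0 (ℤP.≤-trans (ℤP.<⇒≤ m<c) c≤y-m) , s-m , s-c c≤y-m , sym (cancel (+ m) y))
      where
        reorder : ∀ c m y → y - m - c ≡ y - (c + m)
        reorder = solve-∀
        cancel : ∀ m y → m + (y - m) ≡ y
        cancel = solve-∀

    primitive-m : Primitive (+ m) Γ c (+ m)
    primitive-m = 0<m , s-m , λ (u , v , u≢0 , v≢0 , su , sv , m≡u+v) →
      ℤP.<⇒≱ m<m+m (subst (+ m + + m ≤_) (sym m≡u+v)
                         (ℤP.+-mono-≤ (InS-≢0⇒≥m su u≢0) (InS-≢0⇒≥m sv v≢0)))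
      where
        m<m+m : + m < + m + + m
        m<m+m = subst (_< + m + + m) (ℤP.+-identityʳ (+ m)) (ℤP.+-monoʳ-< (+ m) 0<m)

    -- The representative of x + mℤ in the window [c, c + m), for x ∈ iΓ with i ≤ h.

    toWindow : ℤ → ℤ
    toWindow x = x + + multiplesBelow m (c - x) * + m

    toWindow-≡[mod] : ∀ x → toWindow x ≡ x [mod + m ]
    toWindow-≡[mod] x = +-*-≡[mod] x (+ multiplesBelow m (c - x))

    toWindow-≥c : ∀ {x} → c ≤ x → toWindow x ≡ x
    toWindow-≥c {x} c≤x =
      trans (cong (λ k → x + + k * + m) (multiplesBelow-nonpos m (ℤP.i≤j⇒i-j≤0 c≤x))) (ℤP.+-identityʳ x)

    toWindow-<c : ∀ {x} → x < c → (c ≤ toWindow x) × (toWindow x < c + + m)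
    toWindow-<c {x} x<c =
      ≤-byDiff (ℤP.i≤j⇒0≤j-i (≤-multiplesBelow-* m (c - x))) (reorder₁ c x w) ,
      <-byDiff (i<j⇒0≤j-i-1 (multiplesBelow-*-< m (i<j⇒0<j-i x<c))) (reorder₂ c x w (+ m))
      where
        w = + multiplesBelow m (c - x) * + m
        reorder₁ : ∀ c x w → x + w - c ≡ w - (c - x)
        reorder₁ = solve-∀
        reorder₂ : ∀ c x w m → c + m - (x + w) ≡ (c - x + m - w - + 1) + + 1
        reorder₂ = solve-∀

    toWindow-window : ∀ {i x} → Sumset Γ i x → i ℕ.≤ h → (c ≤ toWindow x) × (toWindow x < c + + m)
    toWindow-window {i} {x} s i≤h with i ℕ.<? h
    ... | yes i<h = toWindow-<c (Sumset-<c s i<h)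
    ... | no  i≮h = subst (λ y → c ≤ y × y < c + + m) (sym (toWindow-≥c c≤x)) (c≤x , Sumset-<c+m s i≤h)
      where c≤x = Sumset-≥c s (ℕP.≮⇒≥ i≮h)

    toWindow-decomposable : ∀ {i x} → Sumset Γ i x → i ℕ.≤ h → Decomposable (toWindow x)
    toWindow-decomposable {i} {x} s i≤h =
      Rep-heavy⇒Decomposable (rep i (multiplesBelow m (c - x)) x s refl) (heavy i s)
      where
        heavy : ∀ i → Sumset Γ i x → 2 ℕ.≤ i ℕ.+ multiplesBelow m (c - x)
        heavy zero          s = <-multiplesBelow⇐ m {1} (subst₂ _<_ (sym (ℤP.*-identityˡ (+ m)))
                                  (sym (trans (cong (_-_ c) (Sumset-zero⇒≡0 s)) (ℤP.+-identityʳ c))) m<c)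
        heavy (suc zero)    s = s≤s (<-multiplesBelow⇐ m {0} (i<j⇒0<j-i (Sumset-<c s 1<h)))
        heavy (suc (suc i)) _ = s≤s (s≤s z≤n)

    window : List ℤ
    window = applyDownFrom (λ j → c + + j) m

    ∈-window⁻ : ∀ {y} → y ∈ window → (c ≤ y) × (y < c + + m)
    ∈-window⁻ p with j , j<m , refl ← ∈-applyDownFrom⁻ (λ j → c + + j) p =
      0≤j⇒i≤i+j (+≤+ z≤n) , ℤP.+-monoʳ-< c (+<+ j<m)

    ∈-window⁺ : ∀ {y} → c ≤ y → y < c + + m → y ∈ window
    ∈-window⁺ {y} c≤y y<c+m = subst (_∈ window) c+[y-c]≡y (∈-applyDownFrom⁺ (λ j → c + + j) ∣y-c∣<m)
      where
        +∣y-c∣≡y-c : + ∣ y - c ∣ ≡ y - c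
        +∣y-c∣≡y-c = ℤP.0≤i⇒+∣i∣≡i (ℤP.i≤j⇒0≤j-i c≤y)
        cancel : ∀ c y → c + (y - c) ≡ y
        cancel = solve-∀
        c+[y-c]≡y : c + + ∣ y - c ∣ ≡ y
        c+[y-c]≡y = trans (cong (_+_ c) +∣y-c∣≡y-c) (cancel c y)
        reorder : ∀ c m y → m - (y - c) ≡ (c + m - y - + 1) + + 1
        reorder = solve-∀
        ∣y-c∣<m : ∣ y - c ∣ ℕ.< m
        ∣y-c∣<m = ℤP.drop‿+<+ (subst (_< + m) (sym +∣y-c∣≡y-c)
                                     (<-byDiff (i<j⇒0≤j-i-1 y<c+m) (reorder c (+ m) y)))

    Unique-window : Unique window
    Unique-window = UP.applyDownFrom⁺₁ (λ j → c + + j) m λ j<i _ c+i≡c+j →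
      ℕP.<-irrefl (sym (ℤP.+-injective (+-cancelˡ c _ _ c+i≡c+j))) j<i

    length-window : length window ≡ m
    length-window = length-applyDownFrom (λ j → c + + j) m

    ray : ℤ → List ℤ
    ray x = applyDownFrom (λ j → x + + j * + m) (multiplesBelow m (c - x))

    Unique-ray : ∀ x → Unique (ray x)
    Unique-ray x = UP.applyDownFrom⁺₁ _ _ λ j<i _ x+im≡x+jm →
      ℕP.<-irrefl (sym (ℤP.+-injective (ℤP.*-cancelʳ-≡ _ _ (+ m) (+-cancelˡ x _ _ x+im≡x+jm)))) j<i

    ray-≡[mod] : ∀ {x y} → y ∈ ray x → y ≡ x [mod + m ]
    ray-≡[mod] {x} p with j , _ , refl ← ∈-applyDownFrom⁻ (λ j → x + + j * + m) p = +-*-≡[mod] x (+ j)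

    below : List ℤ
    below = concatMap ray (sumsBelow Γ h)

    windowImages : List ℤ
    windowImages = map toWindow (sumsBelow Γ (suc h))

    ∈-windowImages⁻ : ∀ {y} → y ∈ windowImages → ∃[ i ] ∃[ x ] (i ℕ.≤ h × Sumset Γ i x × y ≡ toWindow x)
    ∈-windowImages⁻ p with x , x∈ , refl ← ∈-map⁻ toWindow p =
      let i , i<1+h , s = ∈-sumsBelow⁻ Γ (suc h) x∈ in i , x , ℕP.≤-pred i<1+h , s , refl

    primitivesAbove : List ℤ
    primitivesAbove = filter (_∉? windowImages) window

    k ℓ r : ℕ
    k = sum (map (λ x → multiplesBelow m (c - x)) (sumsBelow Γ h))
    ℓ = suc (length Γ)
    r = length primitivesAbove

    q E : ℤ
    q = ceiling (c ÷ + m)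
    E = + k * + ℓ + q * + r - c

    Incongruent : ℤ → ℤ → Set
    Incongruent x y = ¬ x ≡ y [mod + m ]

    module _ (cf : CollisionFree h (+ m) Γ) where

      incongruent : ∀ {i j x y} → i ℕ.≤ h → j ℕ.≤ h → i ≢ j → Sumset Γ i x → Sumset Γ j y → Incongruent x y
      incongruent i≤h j≤h i≢j sx sy x≡y = proj₂ cf _ _ i≤h j≤h i≢j _ _ sx sy (divides x≡y)

      Unique-sums-h : Unique (sums Γ h)
      Unique-sums-h with proj₁ cf
      ... | n , (L , L-unique , L⇔Γ , L-length) , (V , V-unique , V⇔hΓ , V-length) =
        ⊆∧length-≤⇒Unique ℤ._≟_ V-unique (λ q → ∈-sums⁺ Γ h (Equivalence.to (V⇔hΓ _) q))
          (ℕP.≤-reflexive length-sums≡length-V)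
        where
          open ≡-Reasoning
          length-Γ : length Γ ≡ n
          length-Γ = trans (Unique∧⊆∧⊇⇒length-≡ Γ-unique L-unique (Equivalence.from (L⇔Γ _))
                                                                   (Equivalence.to (L⇔Γ _)))
                           L-length
          length-sums≡length-V : length (sums Γ h) ≡ length V
          length-sums≡length-V = begin
            length (sums Γ h)           ≡⟨ length-sums Γ h ⟩
            multichoose (length Γ) h    ≡⟨ multichoose≡C (length Γ) h ⟩
            (length Γ ℕ.+ h ℕ.∸ 1) C h  ≡⟨ cong (λ n → (n ℕ.+ h ℕ.∸ 1) C h) length-Γ ⟩
            (n ℕ.+ h ℕ.∸ 1) C h         ≡⟨ V-length ⟨
            length V                    ∎

      sums-incongruent : ∀ {i} → i ℕ.≤ h → AllPairs Incongruent (sums Γ i)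
      sums-incongruent {i} i≤h = AllPairs-fromUnique (Unique-sums-≤ Γ i≤h Unique-sums-h)
        (λ p q x≢y x≡y → x≢y (Sumset-≡[mod]⇒≡ (∈-sums⁻ Γ i p) (∈-sums⁻ Γ i q) i≤h x≡y))

      sumsBelow-incongruent : ∀ {k} → k ℕ.≤ suc h → AllPairs Incongruent (sumsBelow Γ k)
      sumsBelow-incongruent {zero}  _     = []
      sumsBelow-incongruent {suc k} k<1+h =
        APP.++⁺ (sumsBelow-incongruent (ℕP.<⇒≤ k<1+h)) (sums-incongruent k≤h)
                (All.tabulate λ p → All.tabulate λ q → across p q)
        where
          k≤h = ℕP.≤-pred k<1+h
          across : ∀ {x y} → x ∈ sumsBelow Γ k → y ∈ sums Γ k → Incongruent x y
          across p q = let i , i<k , sx = ∈-sumsBelow⁻ Γ k p in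
            incongruent (ℕP.≤-trans (ℕP.<⇒≤ i<k) k≤h) k≤h (ℕP.<⇒≢ i<k) sx (∈-sums⁻ Γ k q)

      primitive-γ : ∀ {γ} → γ ∈ Γ → Primitive (+ m) Γ c γ
      primitive-γ {γ} γ∈Γ = ℤP.<-trans 0<m (m<γ γ∈Γ) , s-Γ γ∈Γ , λ γ-decomposable →
        let r , 2≤w = Decomposable⇒heavyRep (ℤP.<-trans γ<c c<c+m) γ-decomposable in not-heavy r 2≤w
        where
          γ<c = Sumset-<c (Sumset-single γ∈Γ) 1<h
          not-heavy : (r : Rep γ) → 2 ℕ.≤ weight r → ⊥
          not-heavy (rep i j x s refl) 2≤w with i ℕ.<? h
          ... | no i≮h = ℤP.<⇒≱ γ<c (ℤP.≤-trans (Sumset-≥c s (ℕP.≮⇒≥ i≮h)) (≤-+-multiple x j))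
          ... | yes i<h with i ℕ.≟ 1
          ...   | no i≢1   = incongruent (ℕP.<⇒≤ i<h) (ℕP.<⇒≤ 1<h) i≢1 s (Sumset-single γ∈Γ) x≡γ[mod]
            where x≡γ[mod] = ≡[mod]-sym (+-*-≡[mod] x (+ j))
          ...   | yes refl = ℕP.<-irrefl (cong suc (sym j≡0)) 2≤w
            where
              x≡γ : x ≡ x + + j * + m
              x≡γ = Sumset-≡[mod]⇒≡ s (Sumset-single γ∈Γ) (ℕP.<⇒≤ 1<h) (≡[mod]-sym (+-*-≡[mod] x (+ j)))
              j≡0 : j ≡ 0
              j≡0 = ℤP.+-injective (ℤP.*-cancelʳ-≡ (+ j) (+ 0) (+ m)
                      (sym (+-cancelˡ x _ _ (trans (ℤP.+-identityʳ x) x≡γ))))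

      Rep-weight≤1⇒generator : ∀ {y} (r : Rep y) → weight r ℕ.≤ 1 → + 0 < y → y ∈ + m ∷ Γ
      Rep-weight≤1⇒generator (rep zero zero x s refl) _ 0<y =
        ⊥-elim (ℤP.<-irrefl (sym (trans (ℤP.+-identityʳ x) (Sumset-zero⇒≡0 s))) 0<y)
      Rep-weight≤1⇒generator (rep zero (suc zero) x s refl) _ _ =
        here (trans (cong (_+ + 1 * + m) (Sumset-zero⇒≡0 s)) (trans (ℤP.+-identityˡ _) (ℤP.*-identityˡ (+ m))))
      Rep-weight≤1⇒generator (rep (suc zero) zero _ (sum-step {a = a} a∈Γ sum-zero) refl) _ _ =
        there (subst (_∈ Γ) (sym (trans (ℤP.+-identityʳ (a + + 0)) (ℤP.+-identityʳ a))) a∈Γ)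
      Rep-weight≤1⇒generator (rep zero          (suc (suc j)) _ _ refl) (s≤s ())
      Rep-weight≤1⇒generator (rep (suc zero)    (suc j)       _ _ refl) (s≤s ())
      Rep-weight≤1⇒generator (rep (suc (suc i)) j             _ _ refl) (s≤s ())

      Card-primitive-below : Card (λ y → Primitive (+ m) Γ c y × y < c) ℓ
      Card-primitive-below =
        + m ∷ Γ , All.tabulate (λ γ∈Γ m≡γ → ℤP.<-irrefl m≡γ (m<γ γ∈Γ)) ∷ Γ-unique ,
        (λ y → mk⇔ sound complete) , refl
        where
          sound : ∀ {y} → y ∈ + m ∷ Γ → Primitive (+ m) Γ c y × y < c
          sound (here refl)  = primitive-m , m<c
          sound (there γ∈Γ) = primitive-γ γ∈Γ , Sumset-<c (Sumset-single γ∈Γ) 1<h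
          complete : ∀ {y} → Primitive (+ m) Γ c y × y < c → y ∈ + m ∷ Γ
          complete ((0<y , sy , indecomposable) , y<c) with InS⇒≥c⊎Rep sy
          ... | inj₁ c≤y = ⊥-elim (ℤP.<⇒≱ y<c c≤y)
          ... | inj₂ r with weight r ℕ.≤? 1
          ...   | yes w≤1 = Rep-weight≤1⇒generator r w≤1 0<y
          ...   | no  w≰1 = ⊥-elim (indecomposable (Rep-heavy⇒Decomposable r (ℕP.≰⇒> w≰1)))

      Card-below : Card (λ y → S y × + 0 ≤ y × y < c) k
      Card-below =
        below ,
        Unique-concatMap ray Unique-ray (AllPairs.map disjoint-rays (sumsBelow-incongruent (ℕP.n≤1+n h))) ,
        (λ y → mk⇔ sound complete) ,
        trans (length-concatMap ray (sumsBelow Γ h))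
              (cong sum (map-cong (λ _ → length-applyDownFrom _ _) (sumsBelow Γ h)))
        where
          disjoint-rays : ∀ {x y} → Incongruent x y → Disjoint (ray x) (ray y)
          disjoint-rays x≢y (p , q) = x≢y (≡[mod]-trans (≡[mod]-sym (ray-≡[mod] p)) (ray-≡[mod] q))
          shift : ∀ c x w → c - (x + w) ≡ (c - x - w - + 1) + + 1
          shift = solve-∀
          unshift : ∀ c x w → c - x - w ≡ (c - (x + w) - + 1) + + 1
          unshift = solve-∀
          sound-ray : ∀ {x y} → x ∈ sumsBelow Γ h → y ∈ ray x → S y × + 0 ≤ y × y < c
          sound-ray {x} x∈ y∈ray with j , j<T , refl ← ∈-applyDownFrom⁻ (λ j → x + + j * + m) y∈ray =
            let i , _ , s = ∈-sumsBelow⁻ Γ h x∈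
                sy = Rep⇒InS (rep i j x s refl)
            in sy , InS-nonneg sy , <-byDiff (i<j⇒0≤j-i-1 (<-multiplesBelow⇒ m j<T)) (shift c x (+ j * + m))
          sound : ∀ {y} → y ∈ below → S y × + 0 ≤ y × y < c
          sound p = let _ , x∈ , y∈ray = find (∈-concatMap⁻ ray p) in sound-ray x∈ y∈ray
          complete : ∀ {y} → S y × + 0 ≤ y × y < c → y ∈ below
          complete (sy , _ , y<c) with InS⇒≥c⊎Rep sy
          ... | inj₁ c≤y = ⊥-elim (ℤP.<⇒≱ y<c c≤y)
          ... | inj₂ (rep i j x s refl) with i ℕ.<? h
          ...   | no  i≮h = ⊥-elim (ℤP.<⇒≱ y<c (ℤP.≤-trans (Sumset-≥c s (ℕP.≮⇒≥ i≮h)) (≤-+-multiple x j)))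
          ...   | yes i<h = ∈-concatMap⁺ ray (lose (∈-sumsBelow⁺ Γ i<h s)
                              (∈-applyDownFrom⁺ (λ j → x + + j * + m)
                              (<-multiplesBelow⇐ m {j} (<-byDiff (i<j⇒0≤j-i-1 y<c) (unshift c x (+ j * + m))))))

      Unique-windowImages : Unique windowImages
      Unique-windowImages =
        AllPairs.map (λ ix≢iy ix≡iy → ix≢iy (subst (_ ≡_[mod + m ]) ix≡iy ≡[mod]-refl))
          (APP.map⁺ {R = Incongruent} (AllPairs.map toWindow-incongruent (sumsBelow-incongruent ℕP.≤-refl)))
        where
          toWindow-incongruent : ∀ {x y} → Incongruent x y → Incongruent (toWindow x) (toWindow y)
          toWindow-incongruent {x} {y} x≢y ix≡iy =
            x≢y (≡[mod]-trans (≡[mod]-sym (toWindow-≡[mod] x)) (≡[mod]-trans ix≡iy (toWindow-≡[mod] y)))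

      window∖images⇒Primitive : ∀ {y} → c ≤ y → y < c + + m → y ∉ windowImages → Primitive (+ m) Γ c y
      window∖images⇒Primitive {y} c≤y y<c+m y∉images =
        ℤP.<-≤-trans (ℤP.<-trans 0<m m<c) c≤y , s-c c≤y , λ y-decomposable →
          let r , _ = Decomposable⇒heavyRep y<c+m y-decomposable in not-rep r
        where
          not-rep : Rep y → ⊥
          not-rep (rep i j x s refl) with i ℕ.≤? h
          ... | no  i≰h = ℤP.<⇒≱ y<c+m (ℤP.≤-trans (ℤP.<⇒≤ (Sumset->c+m s (ℕP.≰⇒> i≰h))) (≤-+-multiple x j))
          ... | yes i≤h =
            y∉images (subst (_∈ windowImages) (sym y≡toWindow-x)
                            (∈-map⁺ toWindow (∈-sumsBelow⁺ Γ (s≤s i≤h) s)))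
            where
              y≡toWindow-x : x + + j * + m ≡ toWindow x
              y≡toWindow-x = ≡[mod]-window m c≤y y<c+m
                (proj₁ (toWindow-window s i≤h)) (proj₂ (toWindow-window s i≤h))
                (≡[mod]-trans (+-*-≡[mod] x (+ j)) (≡[mod]-sym (toWindow-≡[mod] x)))

      Card-primitive-above : Card (λ y → Primitive (+ m) Γ c y × c ≤ y) r
      Card-primitive-above =
        primitivesAbove , UP.filter⁺ (_∉? windowImages) Unique-window , (λ y → mk⇔ sound complete) , refl
        where
          sound : ∀ {y} → y ∈ primitivesAbove → Primitive (+ m) Γ c y × c ≤ y
          sound p = let y∈window , y∉images = ∈-filter⁻ (_∉? windowImages) p
                        c≤y , y<c+m = ∈-window⁻ y∈window
                    in window∖images⇒Primitive c≤y y<c+m y∉images , c≤y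
          complete : ∀ {y} → Primitive (+ m) Γ c y × c ≤ y → y ∈ primitivesAbove
          complete (y-primitive@(_ , _ , indecomposable) , c≤y) =
            ∈-filter⁺ (_∉? windowImages) (∈-window⁺ c≤y (Primitive⇒<c+m y-primitive)) λ y∈images →
              let _ , _ , i≤h , s , y≡toWindow-x = ∈-windowImages⁻ y∈images
              in indecomposable (subst Decomposable (sym y≡toWindow-x) (toWindow-decomposable s i≤h))

      length-primitivesAbove : length primitivesAbove ℕ.+ length windowImages ≡ m
      length-primitivesAbove = begin
        length primitivesAbove ℕ.+ length windowImages  ≡⟨ length-++ primitivesAbove ⟨
        length (primitivesAbove ++ windowImages)
          ≡⟨ Unique∧⊆∧⊇⇒length-≡ unique Unique-window ⊆window window⊆ ⟩
        length window                                   ≡⟨ length-window ⟩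
        m                                               ∎
        where
          open ≡-Reasoning
          unique : Unique (primitivesAbove ++ windowImages)
          unique = UP.++⁺ (UP.filter⁺ (_∉? windowImages) Unique-window) Unique-windowImages
                          (λ (p , q) → proj₂ (∈-filter⁻ (_∉? windowImages) {xs = window} p) q)
          ⊆window : primitivesAbove ++ windowImages ⊆ window
          ⊆window p with ∈-++⁻ primitivesAbove p
          ... | inj₁ q = proj₁ (∈-filter⁻ (_∉? windowImages) {xs = window} q)
          ... | inj₂ q with _ , _ , i≤h , s , refl ← ∈-windowImages⁻ q =
            ∈-window⁺ (proj₁ (toWindow-window s i≤h)) (proj₂ (toWindow-window s i≤h))
          window⊆ : window ⊆ primitivesAbove ++ windowImages
          window⊆ {y} p with y ∈? windowImages
          ... | yes y∈images = ∈-++⁺ʳ primitivesAbove y∈images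
          ... | no  y∉images = ∈-++⁺ˡ (∈-filter⁺ (_∉? windowImages) p y∉images)

      eliahou : HasEliahou (+ m) Γ c E
      eliahou = k , ℓ , r , Card-below , Card-primitive-below , Card-primitive-above , refl

      r+Σ|sums|≡m : r ℕ.+ sumBelow (suc h) (λ i → length (sums Γ i)) ≡ m
      r+Σ|sums|≡m = begin
        r ℕ.+ sumBelow (suc h) (λ i → length (sums Γ i))  ≡⟨ cong (r ℕ.+_) (length-sumsBelow Γ (suc h)) ⟨
        r ℕ.+ length (sumsBelow Γ (suc h))
          ≡⟨ cong (r ℕ.+_) (length-map toWindow (sumsBelow Γ (suc h))) ⟨
        r ℕ.+ length windowImages                          ≡⟨ length-primitivesAbove ⟩
        m                                                  ∎
        where open ≡-Reasoning

  -- Passing from a/b to a/b + 1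

  module Translation {h m c Γ} .{{_ : NonZero m}}
    (sa : StandingAssumptions h m c Γ) (sa⁺ : StandingAssumptions h m (c + + h * + m) (map (_+ + m) Γ))
    (cf : CollisionFree h (+ m) Γ) where

    private
      module S  = NumericalSemigroup sa
      module S⁺ = NumericalSemigroup sa⁺
      Γ⁺ = map (_+ + m) Γ
      c⁺ = c + + h * + m
      cf⁺ : CollisionFree h (+ m) Γ⁺
      cf⁺ = Equivalence.from (CollisionFree-map-+ h (+ m) Γ) cf
      n = length Γ
      W = sumBelow h (λ i → (h ℕ.∸ i) ℕ.* multichoose n i)
      L = sumBelow (suc h) (multichoose n)
      open ≡-Reasoning

    length-sums-map-+ : ∀ i → length (sums Γ⁺ i) ≡ multichoose n i
    length-sums-map-+ i = begin
      length (sums Γ⁺ i)         ≡⟨ cong length (sums-map-+ (+ m) Γ i) ⟩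
      length (map _ (sums Γ i))  ≡⟨ length-map _ (sums Γ i) ⟩
      length (sums Γ i)          ≡⟨ length-sums Γ i ⟩
      multichoose n i            ∎

    m≡r+L : m ≡ S.r ℕ.+ L
    m≡r+L = trans (sym (S.r+Σ|sums|≡m cf)) (cong (S.r ℕ.+_) (sumBelow-cong (suc h) λ i _ → length-sums Γ i))

    r⁺≡r : S⁺.r ≡ S.r
    r⁺≡r = ℕP.+-cancelʳ-≡ L S⁺.r S.r (begin
      S⁺.r ℕ.+ L                                             ≡⟨ cong (S⁺.r ℕ.+_) (sumBelow-cong (suc h) λ i _ →
                                                                  sym (length-sums-map-+ i)) ⟩
      S⁺.r ℕ.+ sumBelow (suc h) (λ i → length (sums Γ⁺ i))   ≡⟨ S⁺.r+Σ|sums|≡m cf⁺ ⟩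
      m                                                      ≡⟨ m≡r+L ⟩
      S.r ℕ.+ L                                              ∎)

    multiplesBelow-translate : ∀ {i x} → Sumset Γ i x → i ℕ.< h →
      multiplesBelow m (c⁺ - (x + + i * + m)) ≡ multiplesBelow m (c - x) ℕ.+ (h ℕ.∸ i)
    multiplesBelow-translate {i} {x} s i<h = begin
      multiplesBelow m (c⁺ - (x + + i * + m))         ≡⟨ cong (multiplesBelow m) (regroup c (+ h) (+ i) x (+ m)) ⟩
      multiplesBelow m ((c - x) + (+ h - + i) * + m)  ≡⟨ cong (λ t → multiplesBelow m ((c - x) + t * + m)) h-i≡h∸i ⟩
      multiplesBelow m ((c - x) + + (h ℕ.∸ i) * + m)  ≡⟨ multiplesBelow-+ m (h ℕ.∸ i) (i<j⇒0<j-i (S.Sumset-<c s i<h)) ⟩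
      multiplesBelow m (c - x) ℕ.+ (h ℕ.∸ i)          ∎
      where
        regroup : ∀ c h i x m → c + h * m - (x + i * m) ≡ (c - x) + (h - i) * m
        regroup = solve-∀
        h-i≡h∸i : + h - + i ≡ + (h ℕ.∸ i)
        h-i≡h∸i = trans (ℤP.m-n≡m⊖n h i) (ℤP.⊖-≥ (ℕP.<⇒≤ i<h))

    k⁺≡k+W : S⁺.k ≡ S.k ℕ.+ W
    k⁺≡k+W = begin
      sum (map F⁺ (sumsBelow Γ⁺ h))                                        ≡⟨ sum-map-sumsBelow F⁺ Γ⁺ h ⟩
      sumBelow h (λ i → sum (map F⁺ (sums Γ⁺ i)))                          ≡⟨ sumBelow-cong h level ⟩
      sumBelow h (λ i → sum (map F (sums Γ i)) ℕ.+ (h ℕ.∸ i) ℕ.* multichoose n i)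
        ≡⟨ sumBelow-+ h (λ i → sum (map F (sums Γ i))) _ ⟩
      sumBelow h (λ i → sum (map F (sums Γ i))) ℕ.+ W                      ≡⟨ cong (ℕ._+ W) (sum-map-sumsBelow F Γ h) ⟨
      S.k ℕ.+ W                                                            ∎
      where
        F F⁺ : ℤ → ℕ
        F  x = multiplesBelow m (c - x)
        F⁺ x = multiplesBelow m (c⁺ - x)
        level : ∀ i → i ℕ.< h →
                sum (map F⁺ (sums Γ⁺ i)) ≡ sum (map F (sums Γ i)) ℕ.+ (h ℕ.∸ i) ℕ.* multichoose n i
        level i i<h = begin
          sum (map F⁺ (sums Γ⁺ i))                           ≡⟨ cong (sum ∘ map F⁺) (sums-map-+ (+ m) Γ i) ⟩
          sum (map F⁺ (map (_+ + i * + m) (sums Γ i)))       ≡⟨ cong sum (map-∘ (sums Γ i)) ⟨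
          sum (map (F⁺ ∘ (_+ + i * + m)) (sums Γ i))         ≡⟨ cong sum (map-cong-local (All.tabulate λ p →
                                                                  multiplesBelow-translate (∈-sums⁻ Γ i p) i<h)) ⟩
          sum (map (λ x → F x ℕ.+ (h ℕ.∸ i)) (sums Γ i))     ≡⟨ sum-map-+ F (h ℕ.∸ i) (sums Γ i) ⟩
          sum (map F (sums Γ i)) ℕ.+ (h ℕ.∸ i) ℕ.* length (sums Γ i)
            ≡⟨ cong (λ t → sum (map F (sums Γ i)) ℕ.+ (h ℕ.∸ i) ℕ.* t) (length-sums Γ i) ⟩
          sum (map F (sums Γ i)) ℕ.+ (h ℕ.∸ i) ℕ.* multichoose n i   ∎

    E⁺≡E : S⁺.E ≡ S.E
    E⁺≡E = begin
      + S⁺.k * + suc (length Γ⁺) + ceiling (c⁺ ÷ + m) * + S⁺.r - c⁺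
        ≡⟨ cong₂ (λ k n → + k * + suc n + ceiling (c⁺ ÷ + m) * + S⁺.r - c⁺) k⁺≡k+W (length-map (_+ + m) Γ) ⟩
      + (S.k ℕ.+ W) * + suc n + ceiling (c⁺ ÷ + m) * + S⁺.r - c⁺
        ≡⟨ cong₂ (λ q r → + (S.k ℕ.+ W) * + suc n + q * + r - c⁺) (ceiling-÷-+-* m c (+ h)) r⁺≡r ⟩
      + (S.k ℕ.+ W) * + suc n + (S.q + + h) * + S.r - (c + + h * + m)
        ≡⟨ cong (λ t → + (S.k ℕ.+ W) * + suc n + (S.q + + h) * + S.r - (c + + h * + t)) m≡r+L ⟩
      + (S.k ℕ.+ W) * + suc n + (S.q + + h) * + S.r - (c + + h * (+ S.r + + L))
        ≡⟨ regroup (+ S.k) (+ W) (+ suc n) S.q (+ h) (+ S.r) c (+ L) ⟩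
      S.E + (+ W * + suc n - + h * + L)
        ≡⟨ cong (λ t → S.E + (t - + h * + L)) W*[1+n]≡h*L ⟩
      S.E + (+ h * + L - + h * + L)
        ≡⟨ cong (_+_ S.E) (ℤP.+-inverseʳ (+ h * + L)) ⟩
      S.E + + 0
        ≡⟨ ℤP.+-identityʳ S.E ⟩
      S.E ∎
      where
        regroup : ∀ k w s q h r c l →
          (k + w) * s + (q + h) * r - (c + h * (r + l)) ≡ (k * s + q * r - c) + (w * s - h * l)
        regroup = solve-∀
        W*[1+n]≡h*L : + W * + suc n ≡ + h * + L
        W*[1+n]≡h*L = begin
          + W * + suc n    ≡⟨ ℤP.pos-* W (suc n) ⟨
          + (W ℕ.* suc n)  ≡⟨ cong +_ (trans (ℕP.*-comm W (suc n)) (multichoose-weighted-sum n h)) ⟩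
          + (h ℕ.* L)      ≡⟨ ℤP.pos-* h L ⟩
          + h * + L        ∎

    eliahou⁺ : HasEliahou (+ m) Γ⁺ c⁺ S.E
    eliahou⁺ = subst (HasEliahou (+ m) Γ⁺ c⁺) E⁺≡E (S⁺.eliahou cf⁺)

  cParam-+ : ∀ h a b .{{_ : NonZero b}} τ m → cParam h (a + + b) b τ m ≡ cParam h a b τ m + + h * m
  cParam-+ h a b τ m = begin
    floor (((a + + b) * + h * m) ÷ + b) - m - τ
      ≡⟨ cong (λ t → floor (t ÷ + b) - m - τ) (distrib a (+ h) m (+ b)) ⟩
    floor ((a * + h * m + (+ h * m) * + b) ÷ + b) - m - τ
      ≡⟨ cong (λ t → t - m - τ) (floor-÷-+-* b (a * + h * m) (+ h * m)) ⟩
    floor ((a * + h * m) ÷ + b) + + h * m - m - τ         ≡⟨ reorder (floor ((a * + h * m) ÷ + b)) (+ h * m) m τ ⟩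
    floor ((a * + h * m) ÷ + b) - m - τ + + h * m         ∎
    where
      open ≡-Reasoning
      distrib : ∀ a h m b → (a + b) * h * m ≡ a * h * m + (h * m) * b
      distrib = solve-∀
      reorder : ∀ f w m τ → f + w - m - τ ≡ f - m - τ + w
      reorder = solve-∀

  GammaParam-+ : ∀ h .{{_ : NonZero h}} a b .{{_ : NonZero b}} Δ τ m →
                 GammaParam h (a + + b) b Δ τ m ≡ map (_+ m) (GammaParam h a b Δ τ m)
  GammaParam-+ h a b Δ τ m = trans (map-cong shift Δ) (map-∘ Δ)
    where
      c = cParam h a b τ m
      top = floor ((c + m - + 1) ÷ + h)
      shift : ∀ δ → floor ((cParam h (a + + b) b τ m + m - + 1) ÷ + h) - + δ ≡ top - + δ + m
      shift δ = begin
        floor ((cParam h (a + + b) b τ m + m - + 1) ÷ + h) - + δ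
          ≡⟨ cong (λ t → floor ((t + m - + 1) ÷ + h) - + δ) (cParam-+ h a b τ m) ⟩
        floor ((c + + h * m + m - + 1) ÷ + h) - + δ
          ≡⟨ cong (λ t → floor (t ÷ + h) - + δ) (regroup c (+ h) m) ⟩
        floor ((c + m - + 1 + m * + h) ÷ + h) - + δ
          ≡⟨ cong (_- + δ) (floor-÷-+-* h (c + m - + 1) m) ⟩
        top + m - + δ
          ≡⟨ swap top m (+ δ) ⟩
        top - + δ + m ∎
        where
          open ≡-Reasoning
          regroup : ∀ c h m → c + h * m + m - + 1 ≡ c + m - + 1 + m * h
          regroup = solve-∀
          swap : ∀ t m d → t + m - d ≡ t - d + m
          swap = solve-∀

  standingAssumptions : ∀ {h a b Δ τ m} .{{_ : NonZero h}} → 2 ℕ.≤ h → Unique Δ → Standing h a b Δ τ (+ m) →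
                        StandingAssumptions h m (cParam h a b τ (+ m)) (GammaParam h a b Δ τ (+ m))
  standingAssumptions {h} {a} {b} {Δ} {τ} {m} 2≤h Δ-unique
                      (_ , m<c , m<γ , (γ₁ , (γ₁∈Γ , γ₁-min) , w≤m) , _) =
    record
      { 1<h      = 2≤h
      ; m<c      = m<c
      ; Γ-unique = UP.map⁺ (ℤP.+-injective ∘ ℤP.neg-injective ∘ +-cancelˡ top _ _) Δ-unique
      ; γ₀       = γ₁
      ; γ₀∈Γ     = γ₁∈Γ
      ; m<γ      = λ γ∈Γ → m<γ _ γ∈Γ
      ; c≤hγ     = λ γ∈Γ → ℤP.≤-trans c≤hγ₁ (ℤP.*-monoˡ-≤-nonNeg (+ h) (γ₁-min _ γ∈Γ))
      ; hγ<c+m   = hγ<c+m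
      }
    where
      c = cParam h a b τ (+ m)
      top = floor ((c + + m - + 1) ÷ + h)
      c≤hγ₁ : c ≤ + h * γ₁
      c≤hγ₁ = ≤-byDiff (ℤP.i≤j⇒0≤j-i w≤m) (reorder c (+ m) (+ h * γ₁))
        where
          reorder : ∀ c m y → y - c ≡ m - (c + m - y)
          reorder = solve-∀
      hγ<c+m : ∀ {γ} → γ ∈ GammaParam h a b Δ τ (+ m) → + h * γ < c + + m
      hγ<c+m γ∈Γ with δ , _ , refl ← ∈-map⁻ (λ δ → top - + δ) γ∈Γ =
        <-byDiff (ℤP.+-mono-≤ (ℤP.i≤j⇒0≤j-i (floor-÷-*-≤ h (c + + m - + 1))) (0≤+*+ h δ))
                 (reorder c (+ m) top (+ h) (+ δ))
        where
          reorder : ∀ c m t h d → c + m - h * (t - d) ≡ ((c + m - + 1 - t * h) + h * d) + + 1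
          reorder = solve-∀

open import Data.Nat using (ℕ; _≤_)
open import Data.Integer using (ℤ; +_; _+_; _*_)
open import Data.List using (List)
open import Data.List.Relation.Unary.Unique.Propositional using (Unique)
open import Data.Product using (_×_; ∃-syntax)
open import Function.Bundles using (_⇔_)
open import Data.Nat using (zero; suc; z≤n; s≤s; NonZero; >-nonZero)
open import Data.Nat.Properties using (≤-trans)
open import Data.Integer using (-[1+_]; +<+)
open import Data.Product using (_,_)
open import Relation.Binary.PropositionalEquality using (sym; subst; subst₂)

lemma3p4 : (h : ℕ) → 2 ≤ h → (a : ℤ) (b : ℕ) → Farey h a b →
    (Δ : List ℕ) → Unique Δ → (τ m : ℤ) →
    Standing h a b Δ τ m → Standing h (a + + b) b Δ τ m →
    Canonical m (GammaParam h a b Δ τ m) (cParam h a b τ m) →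
    (CollisionFree h m (GammaParam h (a + + b) b Δ τ m)
       ⇔ CollisionFree h m (GammaParam h a b Δ τ m))
    × (CollisionFree h m (GammaParam h a b Δ τ m) →
       ∃[ E ] (HasEliahou m (GammaParam h a b Δ τ m) (cParam h a b τ m) E
             × HasEliahou m (GammaParam h (a + + b) b Δ τ m) (cParam h (a + + b) b τ m) E))
lemma3p4 h 2≤h a zero      (() , _) _ _ _ _ _ _ _
lemma3p4 h 2≤h a (suc _)   _ _ _ _ (+ zero) (+<+ () , _) _ _
lemma3p4 h 2≤h a (suc _)   _ _ _ _ -[1+ _ ] (() , _)     _ _
lemma3p4 h 2≤h a b@(suc _) _ Δ Δ-unique τ (+ m@(suc _)) st st⁺ _ =
  subst (λ Γ⁺ → CollisionFree h (+ m) Γ⁺ ⇔ CollisionFree h (+ m) Γ) (sym Γ⁺≡Γ+m)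
        (CollisionFree-map-+ h (+ m) Γ) ,
  λ cf → NumericalSemigroup.E sa , NumericalSemigroup.eliahou sa cf ,
         subst₂ (λ Γ⁺ c⁺ → HasEliahou (+ m) Γ⁺ c⁺ (NumericalSemigroup.E sa)) (sym Γ⁺≡Γ+m) (sym c⁺≡c+hm)
                (Translation.eliahou⁺ sa sa⁺ cf)
  where
    instance
      h≢0 : NonZero h
      h≢0 = >-nonZero (≤-trans (s≤s z≤n) 2≤h)
    Γ = GammaParam h a b Δ τ (+ m)
    c⁺≡c+hm = cParam-+ h a b τ (+ m)
    Γ⁺≡Γ+m = GammaParam-+ h a b Δ τ (+ m)
    sa = standingAssumptions {h} {a} {b} {Δ} {τ} 2≤h Δ-unique st
    sa⁺ = subst₂ (StandingAssumptions h m) c⁺≡c+hm Γ⁺≡Γ+m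
                 (standingAssumptions {h} {a + + b} {b} {Δ} {τ} 2≤h Δ-unique st⁺)
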